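{- Let $p$ be an odd prime, let $a$ be a positive integer, and let $m$ be an integer with $m\not\equiv0\pmod p$. Then $$\frac{m-4}{2}\sum_{k=0}^{(p^a-1)/2}\frac{k\binom{2k}{k}}{m^k}\equiv\sum_{k=0}^{(p^a-1)/2}\frac{\binom{2k}{k}}{m^k}-p^a\left(\frac{ -m}{p^a}\right)\pmod{p^{a+1}}$$ and $$\frac{m-4}{2}\sum_{k=0}^{p^a-1}\frac{k\binom{2k}{k}}{m^k}\equiv\sum_{k=0}^{p^a-1}\frac{\binom{2k}{k}}{m^k}-p^a\pmod{p^{a+1}}.$$
   Context: $\left(\frac{\cdot}{\cdot}\right)$ is the Jacobi symbol. Congruences between rational numbers whose denominators are prime to $p$ are understood in the ring of rationals with denominator prime to $p$. -}

module Defs where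

open import Data.Nat as ℕ using (ℕ; zero; suc; _∸_)
open import Data.Nat.Divisibility using (_∣_; _∣?_; quotient)
open import Data.Nat.Primality using (Prime; prime?)
open import Data.Nat.Combinatorics using (_C_)
open import Data.Integer as ℤ using (ℤ; +_; -[1+_]; ∣_∣)
open import Data.Rational as ℚ using (ℚ; ↥_; ↧ₙ_; 0ℚ; 1ℚ)
open import Data.List using (List; upTo)
open import Data.Bool.ListAction using (any)
open import Data.Bool using (Bool; true; false; if_then_else_)
open import Data.Product using (_×_)
open import Relation.Nullary using (¬_; yes; no; does)

infix 4 _∣ℤ_
_∣ℤ_ : ℕ → ℤ → Set
d ∣ℤ z = d ∣ ∣ z ∣

legendre : ℤ → ℕ → ℤ
legendre a q with q ∣? ∣ a ∣
... | yes _ = + 0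
... | no  _ =
  if any (λ x → does (q ∣? ∣ (+ x) ℤ.* (+ x) ℤ.- a ∣)) (upTo q)
  then + 1 else -[1+ 0 ]

-- q-adic valuation of n (with fuel; fuel n suffices for n ≥ 1, q ≥ 2).
valFuel : ℕ → ℕ → ℕ → ℕ
valFuel zero     q n = 0
valFuel (suc f) 0 n = 0
valFuel (suc f) 1 n = 0
valFuel (suc f) q@(suc (suc _)) 0 = 0
valFuel (suc f) q@(suc (suc _)) n@(suc _) with q ∣? n
... | yes q∣n = suc (valFuel f q (quotient q∣n))
... | no  _   = 0

val : ℕ → ℕ → ℕ
val q n = valFuel n q n

powℤ : ℤ → ℕ → ℤ
powℤ x zero    = + 1
powℤ x (suc k) = x ℤ.* powℤ x k

jacobiUpTo : ℤ → ℕ → ℕ → ℤ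
jacobiUpTo a n zero    = + 1
jacobiUpTo a n (suc q) with prime? (suc q)
... | yes _ = powℤ (legendre a (suc q)) (val (suc q) n) ℤ.* jacobiUpTo a n q
... | no  _ = jacobiUpTo a n q

jacobi : ℤ → ℕ → ℤ
jacobi a n = jacobiUpTo a n n

-- Rational powers and the rational 1/m (with 1/0 := 0, never used here).
powℚ : ℚ → ℕ → ℚ
powℚ x zero    = 1ℚ
powℚ x (suc k) = x ℚ.* powℚ x k

recipℤ : ℤ → ℚ
recipℤ (+ zero)    = 0ℚ
recipℤ (+ suc n)   = (+ 1) ℚ./ suc n
recipℤ -[1+ n ]    = -[1+ 0 ] ℚ./ suc n

sumTo : ℕ → (ℕ → ℚ) → ℚ
sumTo zero    f = f 0
sumTo (suc N) f = sumTo N f ℚ.+ f (suc N)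

ℕtoℚ : ℕ → ℚ
ℕtoℚ n = (+ n) ℚ./ 1

ℤtoℚ : ℤ → ℚ
ℤtoℚ z = z ℚ./ 1

-- x ≡ y (mod p^e) in the ring ℤ_(p) of rationals with denominator prime to p:
-- x - y (in lowest terms) has denominator prime to p and numerator divisible by p^e.
CongQ : (p e : ℕ) → ℚ → ℚ → Set
CongQ p e x y = (¬ (p ∣ ↧ₙ (x ℚ.- y))) × (p ℕ.^ e ∣ℤ ↥ (x ℚ.- y))

{-# OPTIONS --safe #-}
module Submission where

-- Put f k = C(2k,k)/m^k. Since (k+1)C(2k+2,k+1) = 2(2k+1)C(2k,k), the term D k = (m/2)·k·f k satisfies
-- D (k+1) − D k = f k − ((m−4)/2)·k·f k, so ((m−4)/2)·Σ_{k≤N} k·f k = Σ_{k≤N} f k − D (N+1). Hence 2m^N times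
-- the difference of the two sides of either congruence is the integer 2m^N·T − (N+1)C(2N+2,N+1), where T is
-- the correction term, and 2m^N is prime to p. For N = p^a − 1 this integer is p^a(2m^N − C(2p^a,p^a)), and
-- C(2p^a,p^a) ≡ 2, m^N ≡ 1 (mod p). For N = (p^a − 1)/2 it is 2p^a(m^N·(−m/p^a) − C(p^a − 1,N)), and
-- C(p^a − 1,N) ≡ (−1)^N ≡ m^N·(−m/p^a) (mod p). The binomial congruences follow from p ∣ C(p^a,j) for
-- 0 < j < p^a. The others follow from Euler's criterion, as N = t(1 + p + ⋯ + p^(a−1)) with p = 2t + 1;
-- it is proved by Dirichlet's argument: pairing x with c/x shows (p−1)! ≡ c^t or −c^t according as c is a
-- non-residue or a residue mod p, and c = 1 gives Wilson's theorem.

open import Data.Nat as ℕ using (ℕ; zero; suc; _<_; _≤_; _∸_; s≤s; z≤n)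
import Data.Nat.Properties as ℕP
open import Data.Nat.Divisibility as ℕD using (_∣_; _∣?_; divides; quotient)
open import Data.Nat.DivMod using (m≡m%n+[m/n]*n; m%n<n; m*n/n≡m)
open import Data.Nat.GCD using (module Bézout)
open import Data.Nat.Coprimality as Coprime using (coprime?; coprime-Bézout; coprime-divisor; prime⇒coprime)
open import Data.Nat.Primality
  using (Prime; prime?; euclidsLemma; prime⇒nonZero; prime⇒nonTrivial; prime⇒irreducible)
open import Data.Nat.Combinatorics
  using (_C_; nCk+nC[k+1]≡[n+1]C[k+1]; nC1≡n; nCn≡1; nCk≡nC[n∸k]; k>n⇒nCk≡0)
open import Data.Nat.ListAction using (product)
open import Data.Integer as ℤ using (ℤ; +_; -_; -1ℤ; -[1+_]; ∣_∣)
import Data.Integer.Properties as ℤP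
import Data.Integer.Divisibility.Signed as ℤD
import Data.Integer.DivMod as ℤDM
open import Data.Rational as ℚ using (ℚ; mkℚ; 0ℚ; 1ℚ; toℚᵘ)
import Data.Rational.Properties as ℚP
open import Data.Rational.Unnormalised as ℚᵘ using (mkℚᵘ; *≡*)
import Data.Rational.Unnormalised.Properties as ℚᵘP
open import Data.List using (List; []; _∷_; length; applyUpTo; upTo)
open import Data.List.Properties using (length-applyUpTo)
open import Data.List.Membership.Propositional using (_∈_; _∉_; _─_; find; lose)
open import Data.List.Membership.Propositional.Properties using (∈-applyUpTo⁺; ∈-applyUpTo⁻; ∈-upTo⁺; ∈-upTo⁻)
open import Data.List.Relation.Unary.Any using (here; there)
open import Data.List.Relation.Unary.Any.Properties using (any⁺; any⁻)
open import Data.List.Relation.Unary.All using (All; _∷_)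
open import Data.List.Relation.Unary.All.Properties using (All¬⇒¬Any)
import Data.List.Relation.Unary.AllPairs as AllPairs
open import Data.List.Relation.Unary.Unique.Propositional using (Unique)
open import Data.List.Relation.Unary.Unique.Propositional.Properties using (applyUpTo⁺₁)
open import Data.Bool using (Bool; true; false; T)
open import Data.Bool.ListAction using (any)
open import Data.Unit using (tt)
open import Data.Empty using (⊥-elim)
open import Data.Maybe using (Maybe; just; nothing)
open import Data.Product using (∃; _×_; _,_; proj₁; proj₂)
open import Data.Sum using (_⊎_; inj₁; inj₂; [_,_]′)
open import Function using (_∘_; id; flip; case_of_)
open import Level using (0ℓ)
open import Relation.Nullary using (¬_; Dec; yes; no; does; contradiction)
open import Relation.Binary.Bundles using (Setoid)
import Relation.Binary.Reasoning.Setoid as SetoidReasoning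
open import Relation.Binary.PropositionalEquality
  using (_≡_; _≢_; refl; sym; trans; cong; cong₂; subst; subst₂; module ≡-Reasoning)
open import Algebra.Properties.CommutativeSemigroup ℕP.*-commutativeSemigroup using (x∙yz≈y∙xz)
import Tactic.RingSolver.Core.AlmostCommutativeRing as ACR
import Tactic.RingSolver as RingSolver
import Data.Nat.Tactic.RingSolver as ℕ-Solver
import Data.Integer.Tactic.RingSolver as ℤ-Solver

open import Defs

module ModularArithmetic where

  open import Data.Integer using (_+_; _*_; _-_; _^_)
  open ℤ-Solver using (solve-∀)

  infix 4 _≡_[mod_]

  record _≡_[mod_] (x y : ℤ) (n : ℕ) : Set where
    constructor by-quotient
    field
      quotient : ℤ
      equation : x ≡ y + quotient * + n

  ^-distribʳ-* : ∀ x y n → (x * y) ^ n ≡ x ^ n * y ^ n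
  ^-distribʳ-* x y zero    = refl
  ^-distribʳ-* x y (suc n) = trans (cong (x * y *_) (^-distribʳ-* x y n)) (interchange x y (x ^ n) (y ^ n))
    where interchange : ∀ a b c d → a * b * (c * d) ≡ a * c * (b * d)
          interchange = solve-∀

  module _ {n : ℕ} where

    mod-refl : ∀ {x} → x ≡ x [mod n ]
    mod-refl {x} = by-quotient (+ 0) (identity x (+ n))
      where identity : ∀ x n → x ≡ x + + 0 * n
            identity = solve-∀

    ≡⇒≡[mod] : ∀ {x y} → x ≡ y → x ≡ y [mod n ]
    ≡⇒≡[mod] refl = mod-refl

    mod-sym : ∀ {x y} → x ≡ y [mod n ] → y ≡ x [mod n ]
    mod-sym {y = y} (by-quotient q refl) = by-quotient (- q) (identity y q (+ n))
      where identity : ∀ y q n → y ≡ y + q * n + - q * n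
            identity = solve-∀

    mod-trans : ∀ {x y z} → x ≡ y [mod n ] → y ≡ z [mod n ] → x ≡ z [mod n ]
    mod-trans {z = z} (by-quotient q refl) (by-quotient r refl) =
      by-quotient (r + q) (identity z q r (+ n))
      where identity : ∀ z q r n → z + r * n + q * n ≡ z + (r + q) * n
            identity = solve-∀

    mod-setoid : Setoid 0ℓ 0ℓ
    mod-setoid = record
      { Carrier       = ℤ
      ; _≈_           = _≡_[mod n ]
      ; isEquivalence = record { refl = mod-refl ; sym = mod-sym ; trans = mod-trans }
      }

    module ≡-mod-Reasoning = SetoidReasoning mod-setoid

    mod-+ : ∀ {x x′ y y′} → x ≡ x′ [mod n ] → y ≡ y′ [mod n ] → x + y ≡ x′ + y′ [mod n ]
    mod-+ {x′ = x} {y′ = y} (by-quotient q refl) (by-quotient r refl) =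
      by-quotient (q + r) (identity x y q r (+ n))
      where identity : ∀ x y q r n → x + q * n + (y + r * n) ≡ x + y + (q + r) * n
            identity = solve-∀

    mod-* : ∀ {x x′ y y′} → x ≡ x′ [mod n ] → y ≡ y′ [mod n ] → x * y ≡ x′ * y′ [mod n ]
    mod-* {x′ = x} {y′ = y} (by-quotient q refl) (by-quotient r refl) =
      by-quotient (q * y + x * r + q * r * + n) (identity x y q r (+ n))
      where identity : ∀ x y q r n → (x + q * n) * (y + r * n) ≡ x * y + (q * y + x * r + q * r * n) * n
            identity = solve-∀

    mod-neg : ∀ {x y} → x ≡ y [mod n ] → - x ≡ - y [mod n ]
    mod-neg {y = y} (by-quotient q refl) = by-quotient (- q) (identity y q (+ n))
      where identity : ∀ y q n → - (y + q * n) ≡ - y + - q * n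
            identity = solve-∀

    mod-*ˡ : ∀ c {x y} → x ≡ y [mod n ] → c * x ≡ c * y [mod n ]
    mod-*ˡ c = mod-* (mod-refl {c})

    mod-^ : ∀ {x y} k → x ≡ y [mod n ] → x ^ k ≡ y ^ k [mod n ]
    mod-^ zero    _   = mod-refl
    mod-^ (suc k) x≡y = mod-* x≡y (mod-^ k x≡y)

    x-y≡0⇒x≡y : ∀ {x y} → x - y ≡ + 0 [mod n ] → x ≡ y [mod n ]
    x-y≡0⇒x≡y {x} {y} (by-quotient q x-y≡qn) = by-quotient q (begin
      x               ≡⟨ identity x y ⟩
      y + (x - y)     ≡⟨ cong (λ w → y + w) (trans x-y≡qn (ℤP.+-identityˡ _)) ⟩
      y + q * + n     ∎)
      where open ≡-Reasoning
            identity : ∀ x y → x ≡ y + (x - y)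
            identity = solve-∀

    x≡y⇒x-y≡0 : ∀ {x y} → x ≡ y [mod n ] → x - y ≡ + 0 [mod n ]
    x≡y⇒x-y≡0 {y = y} (by-quotient q refl) = by-quotient q (identity y q (+ n))
      where identity : ∀ y q n → y + q * n - y ≡ + 0 + q * n
            identity = solve-∀

    x+y≡0⇒y≡-x : ∀ {x y} → x + y ≡ + 0 [mod n ] → y ≡ - x [mod n ]
    x+y≡0⇒y≡-x {x} {y} x+y≡0 = subst₂ _≡_[mod n ] (identity x y) (ℤP.+-identityˡ (- x)) (mod-+ x+y≡0 (mod-refl { - x}))
      where identity : ∀ x y → x + y + - x ≡ y
            identity = solve-∀

    mod-neg-injective : ∀ {x y} → - x ≡ - y [mod n ] → x ≡ y [mod n ]
    mod-neg-injective {x} {y} -x≡-y = subst₂ _≡_[mod n ] (ℤP.neg-involutive x) (ℤP.neg-involutive y) (mod-neg -x≡-y)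

    ≡0[mod]⇒∣ : ∀ {x} → x ≡ + 0 [mod n ] → n ∣ ∣ x ∣
    ≡0[mod]⇒∣ (by-quotient q x≡qn) =
      divides ∣ q ∣ (trans (cong ∣_∣ (trans x≡qn (ℤP.+-identityˡ (q * + n)))) (ℤP.abs-* q (+ n)))

    ∣⇒≡0[mod] : ∀ {x} → n ∣ ∣ x ∣ → x ≡ + 0 [mod n ]
    ∣⇒≡0[mod] n∣x with ℤD.∣ᵤ⇒∣ n∣x
    ... | ℤD.divides q x≡qn = by-quotient q (trans x≡qn (sym (ℤP.+-identityˡ _)))

    n^a*w⇒n^[1+a]∣ : ∀ {a u w} → u ≡ + (n ℕ.^ a) * w → w ≡ + 0 [mod n ] → n ℕ.^ suc a ∣ ∣ u ∣
    n^a*w⇒n^[1+a]∣ {a} {w = w} refl w≡0 = subst₂ _∣_ (ℕP.*-comm (n ℕ.^ a) n) (sym (ℤP.abs-* (+ (n ℕ.^ a)) w))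
      (ℕD.*-monoʳ-∣ (n ℕ.^ a) (≡0[mod]⇒∣ w≡0))

  module _ {p : ℕ} (p-prime : Prime p) where

    private instance
      p≢0 : ℕ.NonZero p
      p≢0 = prime⇒nonZero p-prime

    mod-euclid : ∀ x y → x * y ≡ + 0 [mod p ] → x ≡ + 0 [mod p ] ⊎ y ≡ + 0 [mod p ]
    mod-euclid x y xy≡0 with euclidsLemma ∣ x ∣ ∣ y ∣ p-prime
                              (subst (p ∣_) (ℤP.abs-* x y) (≡0[mod]⇒∣ xy≡0))
    ... | inj₁ p∣x = inj₁ (∣⇒≡0[mod] p∣x)
    ... | inj₂ p∣y = inj₂ (∣⇒≡0[mod] p∣y)

    mod-*-≢0 : ∀ {x y} → ¬ x ≡ + 0 [mod p ] → ¬ y ≡ + 0 [mod p ] → ¬ x * y ≡ + 0 [mod p ]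
    mod-*-≢0 {x} {y} x≢0 y≢0 xy≡0 with mod-euclid x y xy≡0
    ... | inj₁ x≡0 = x≢0 x≡0
    ... | inj₂ y≡0 = y≢0 y≡0

    mod-^-≢0 : ∀ {x} k → ¬ x ≡ + 0 [mod p ] → ¬ x ^ k ≡ + 0 [mod p ]
    mod-^-≢0 zero    _   1≡0 =
      ℕP.<⇒≱ (ℕ.nonTrivial⇒n>1 p {{prime⇒nonTrivial p-prime}}) (ℕD.∣⇒≤ (≡0[mod]⇒∣ 1≡0))
    mod-^-≢0 (suc k) x≢0 = mod-*-≢0 x≢0 (mod-^-≢0 k x≢0)

    mod-cancelˡ : ∀ c {x y} → ¬ c ≡ + 0 [mod p ] → c * x ≡ c * y [mod p ] → x ≡ y [mod p ]
    mod-cancelˡ c {x} {y} c≢0 cx≡cy =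
      [ flip contradiction c≢0 , x-y≡0⇒x≡y ]′
        (mod-euclid c (x - y) (subst (_≡ + 0 [mod p ]) (distrib c x y) (x≡y⇒x-y≡0 cx≡cy)))
      where distrib : ∀ c x y → c * x - c * y ≡ c * (x - y)
            distrib = solve-∀

    p^e∣x*d⇒p^e∣x : ∀ e x d → ¬ p ∣ d → p ℕ.^ e ∣ x ℕ.* d → p ℕ.^ e ∣ x
    p^e∣x*d⇒p^e∣x zero    x d _   _ = ℕD.1∣ x
    p^e∣x*d⇒p^e∣x (suc e) x d p∤d p^e∣xd
      with euclidsLemma x d p-prime (ℕD.∣-trans (ℕD.m∣m*n (p ℕ.^ e)) p^e∣xd)
    ... | inj₂ p∣d = contradiction p∣d p∤d
    ... | inj₁ (divides y refl) =
      subst (p ℕ.^ suc e ∣_) (ℕP.*-comm p y) (ℕD.*-monoʳ-∣ p (p^e∣x*d⇒p^e∣x e y d p∤d p^e∣yd))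
      where
        p^e∣yd : p ℕ.^ e ∣ y ℕ.* d
        p^e∣yd = ℕD.*-cancelˡ-∣ p (subst (p ℕ.* p ℕ.^ e ∣_) (shuffle p y d) p^e∣xd)
          where shuffle : ∀ p y d → y ℕ.* p ℕ.* d ≡ p ℕ.* (y ℕ.* d)
                shuffle = ℕ-Solver.solve-∀

  module _ (n : ℕ) .{{_ : ℕ.NonZero n}} where

    residue : ∀ z → ∃ λ r → r < n × z ≡ + r [mod n ]
    residue z = z ℤDM.%ℕ n , ℤDM.n%ℕd<d z n , by-quotient (z ℤDM./ℕ n) (ℤDM.a≡a%ℕn+[a/ℕn]*n z n)

  residue-injective : ∀ {n a b} → a < n → b < n → + a ≡ + b [mod n ] → a ≡ b
  residue-injective {n} {a} {b} a<n b<n a≡b =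
    ℤP.+-injective (ℤP.i-j≡0⇒i≡j (+ a) (+ b) (ℤP.∣i∣≡0⇒i≡0 ∣a-b∣≡0))
    where
      ∣a-b∣<n : ∣ + a - + b ∣ < n
      ∣a-b∣<n = ℕP.≤-<-trans (subst (ℕ._≤ a ℕ.⊔ b) (cong ∣_∣ (sym (ℤP.m-n≡m⊖n a b))) (ℤP.∣m⊝n∣≤m⊔n a b))
                             (ℕP.⊔-lub a<n b<n)
      ∣a-b∣≡0 : ∣ + a - + b ∣ ≡ 0
      ∣a-b∣≡0 with ∣ + a - + b ∣ | ∣a-b∣<n | ≡0[mod]⇒∣ (x≡y⇒x-y≡0 a≡b)
      ... | zero  | _   | _   = refl
      ... | suc d | d<n | n∣d = contradiction n∣d (ℕD.>⇒∤ d<n)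

  private
    lift-ℕ-identity : ∀ a b c d → 1 ℕ.+ a ℕ.* b ≡ c ℕ.* d → + 1 + + a * + b ≡ + c * + d
    lift-ℕ-identity a b c d eq = begin
      + 1 + + a * + b    ≡⟨ cong (λ z → + 1 + z) (ℤP.pos-* a b) ⟨
      + 1 + + (a ℕ.* b)  ≡⟨ ℤP.pos-+ 1 (a ℕ.* b) ⟨
      + (1 ℕ.+ a ℕ.* b)  ≡⟨ cong +_ eq ⟩
      + (c ℕ.* d)        ≡⟨ ℤP.pos-* c d ⟩
      + c * + d          ∎
      where open ≡-Reasoning

  bézout⇒inverse : ∀ {m n} → Bézout.Identity 1 m n → ∃ λ w → + m * w ≡ + 1 [mod n ]
  bézout⇒inverse {m} {n} (Bézout.+- u v 1+vn≡um) = + u , by-quotient (+ v) (begin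
    + m * + u          ≡⟨ ℤP.*-comm (+ m) (+ u) ⟩
    + u * + m          ≡⟨ lift-ℕ-identity v n u m 1+vn≡um ⟨
    + 1 + + v * + n    ∎)
    where open ≡-Reasoning
  bézout⇒inverse {m} {n} (Bézout.-+ u v 1+um≡vn) = - + u , by-quotient (- + v) (begin
    + m * - + u                     ≡⟨ identity (+ m) (+ u) ⟩
    + 1 - (+ 1 + + u * + m)         ≡⟨ cong (λ z → + 1 - z) (lift-ℕ-identity u m v n 1+um≡vn) ⟩
    + 1 - + v * + n                 ≡⟨ identity₂ (+ v) (+ n) ⟩
    + 1 + - + v * + n               ∎)
    where open ≡-Reasoning
          identity : ∀ m u → m * - u ≡ + 1 - (+ 1 + u * m)
          identity = solve-∀
          identity₂ : ∀ v n → + 1 - v * n ≡ + 1 + - v * n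
          identity₂ = solve-∀

module CentralBinomial where

  open import Data.Nat using (_+_; _*_)
  open ℕ-Solver using (solve-∀)

  open ≡-Reasoning

  C-absorb : ∀ n k → suc k * (suc n C suc k) ≡ suc n * (n C k)
  C-absorb n zero = begin
    1 * (suc n C 1)   ≡⟨ ℕP.*-identityˡ _ ⟩
    suc n C 1         ≡⟨ nC1≡n (suc n) ⟩
    suc n             ≡⟨ ℕP.*-identityʳ (suc n) ⟨
    suc n * 1         ∎
  C-absorb zero (suc k) = begin
    suc (suc k) * (1 C suc (suc k))  ≡⟨ cong (suc (suc k) *_) (k>n⇒nCk≡0 {1} {suc (suc k)} (s≤s (s≤s z≤n))) ⟩
    suc (suc k) * 0                  ≡⟨ ℕP.*-zeroʳ (suc (suc k)) ⟩
    0                                ≡⟨ cong (1 *_) (k>n⇒nCk≡0 {0} {suc k} (s≤s z≤n)) ⟨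
    1 * (0 C suc k)                  ∎
  C-absorb (suc n) (suc k) = begin
    suc (suc k) * (suc (suc n) C suc (suc k))
      ≡⟨ cong (suc (suc k) *_) (nCk+nC[k+1]≡[n+1]C[k+1] (suc n) (suc k)) ⟨
    suc (suc k) * (x + y)
      ≡⟨ expand (suc k) x y ⟩
    suc k * x + x + suc (suc k) * y
      ≡⟨ cong₂ (λ u v → u + x + v) (C-absorb n k) (C-absorb n (suc k)) ⟩
    suc n * (n C k) + x + suc n * (n C suc k)
      ≡⟨ collect (suc n) (n C k) (n C suc k) x ⟩
    suc n * (n C k + n C suc k) + x
      ≡⟨ cong (λ u → suc n * u + x) (nCk+nC[k+1]≡[n+1]C[k+1] n k) ⟩
    suc n * x + x
      ≡⟨ +-*-suc (suc n) x ⟩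
    suc (suc n) * x
      ∎
    where
      x = suc n C suc k
      y = suc n C suc (suc k)
      expand : ∀ k x y → suc k * (x + y) ≡ k * x + x + suc k * y
      expand = solve-∀
      collect : ∀ m a b x → m * a + x + m * b ≡ m * (a + b) + x
      collect = solve-∀
      +-*-suc : ∀ m x → m * x + x ≡ suc m * x
      +-*-suc = solve-∀

  C-sym : ∀ a b → (a + b) C a ≡ (a + b) C b
  C-sym a b = trans (nCk≡nC[n∸k] (ℕP.m≤m+n a b)) (cong ((a + b) C_) (ℕP.m+n∸m≡n a b))

  central-C-step : ∀ n → suc n * ((2 * suc n) C suc n) ≡ 2 * suc (2 * n) * ((2 * n) C n)
  central-C-step n = begin
    suc n * (2 * suc n C suc n)
      ≡⟨ cong (λ m → suc n * (m C suc n)) (two-suc n) ⟩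
    suc n * (suc (suc (2 * n)) C suc n)
      ≡⟨ C-absorb (suc (2 * n)) n ⟩
    suc (suc (2 * n)) * (suc (2 * n) C n)
      ≡⟨ cong (λ c → suc (suc (2 * n)) * c) (odd-C-sym n) ⟩
    suc (suc (2 * n)) * (suc (2 * n) C suc n)
      ≡⟨ regroup n (suc (2 * n) C suc n) ⟩
    2 * (suc n * (suc (2 * n) C suc n))
      ≡⟨ cong (2 *_) (C-absorb (2 * n) n) ⟩
    2 * (suc (2 * n) * (2 * n C n))
      ≡⟨ ℕP.*-assoc 2 (suc (2 * n)) (2 * n C n) ⟨
    2 * suc (2 * n) * (2 * n C n)
      ∎
    where
      two-suc : ∀ n → 2 * suc n ≡ suc (suc (2 * n))
      two-suc = solve-∀
      regroup : ∀ n c → suc (suc (2 * n)) * c ≡ 2 * (suc n * c)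
      regroup = solve-∀
      odd-C-sym : ∀ n → suc (2 * n) C n ≡ suc (2 * n) C suc n
      odd-C-sym n = subst (λ m → m C n ≡ m C suc n) (shape n) (C-sym n (suc n))
        where shape : ∀ n → n + suc n ≡ suc (2 * n)
              shape = solve-∀

module BinomialsModuloPrimePowers where

  open ModularArithmetic
  open CentralBinomial
  open import Data.Integer using (_+_)
  open ℕ-Solver using (solve-∀)

  pascal-mod : ∀ {d} m n k → + (m C k) ≡ + (n C k) [mod d ] → + (m C suc k) ≡ + (n C suc k) [mod d ] →
               + (suc m C suc k) ≡ + (suc n C suc k) [mod d ]
  pascal-mod {d} m n k ≡k ≡1+k =
    subst₂ _≡_[mod d ] (pascal m) (pascal n) (mod-+ ≡k ≡1+k)
    where pascal : ∀ m → + (m C k) + + (m C suc k) ≡ + (suc m C suc k)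
          pascal m = trans (sym (ℤP.pos-+ (m C k) (m C suc k))) (cong +_ (nCk+nC[k+1]≡[n+1]C[k+1] m k))

  module _ {p : ℕ} (p-prime : Prime p) where

    private instance
      p≢0 : ℕ.NonZero p
      p≢0 = prime⇒nonZero p-prime

    module _ (a : ℕ) {Q : ℕ} (p^a≡1+Q : p ℕ.^ a ≡ suc Q) where

      p∣[p^a]C[1+j] : ∀ {j} → suc j < suc Q → p ∣ suc Q C suc j
      p∣[p^a]C[1+j] {j} 1+j<1+Q with p ∣? suc Q C suc j
      ... | yes p∣C = p∣C
      ... | no  p∤C = contradiction (ℕD.∣⇒≤ p^a∣1+j) (ℕP.<⇒≱ (subst (suc j <_) (sym p^a≡1+Q) 1+j<1+Q))
        where
          p^a∣1+j : p ℕ.^ a ∣ suc j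
          p^a∣1+j = p^e∣x*d⇒p^e∣x p-prime a (suc j) (suc Q C suc j) p∤C
                      (subst₂ _∣_ (sym p^a≡1+Q) (sym (C-absorb Q j)) (ℕD.m∣m*n (Q C j)))

      [p^a]C[1+j]≡0 : ∀ {j} → suc j < suc Q → + (suc Q C suc j) ≡ + 0 [mod p ]
      [p^a]C[1+j]≡0 1+j<1+Q = ∣⇒≡0[mod] (p∣[p^a]C[1+j] 1+j<1+Q)

      [p^a-1]C[k]≡±1 : ∀ {k} → k ≤ Q → + (Q C k) ≡ -1ℤ ℤ.^ k [mod p ]
      [p^a-1]C[k]≡±1 {zero}  _   = mod-refl
      [p^a-1]C[k]≡±1 {suc k} k<Q = subst (+ (Q C suc k) ≡_[mod p ]) (sym (ℤP.-1*i≡-i (-1ℤ ℤ.^ k)))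
        (mod-trans (x+y≡0⇒y≡-x pascal≡0) (mod-neg ([p^a-1]C[k]≡±1 (ℕP.<⇒≤ k<Q))))
        where
          pascal≡0 : + (Q C k) + + (Q C suc k) ≡ + 0 [mod p ]
          pascal≡0 = subst (_≡ + 0 [mod p ])
                       (trans (cong +_ (sym (nCk+nC[k+1]≡[n+1]C[k+1] Q k))) (ℤP.pos-+ (Q C k) (Q C suc k)))
                       ([p^a]C[1+j]≡0 (s≤s k<Q))

      [p^a+r]C[k]≡rC[k] : ∀ r {k} → k < suc Q → + ((suc Q ℕ.+ r) C k) ≡ + (r C k) [mod p ]
      [p^a+r]C[k]≡rC[k] _       {zero}  _   = mod-refl
      [p^a+r]C[k]≡rC[k] zero    {suc j} 1+j<1+Q =
        subst₂ (λ m c → + (m C suc j) ≡ + c [mod p ])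
          (sym (ℕP.+-identityʳ (suc Q))) (sym (k>n⇒nCk≡0 {0} {suc j} (s≤s z≤n)))
          ([p^a]C[1+j]≡0 1+j<1+Q)
      [p^a+r]C[k]≡rC[k] (suc r) {suc j} 1+j<1+Q =
        subst (λ m → + (m C suc j) ≡ + (suc r C suc j) [mod p ]) (sym (ℕP.+-suc (suc Q) r))
          (pascal-mod (suc Q ℕ.+ r) r j ([p^a+r]C[k]≡rC[k] r (ℕP.<-trans (ℕP.n<1+n j) 1+j<1+Q)) ([p^a+r]C[k]≡rC[k] r 1+j<1+Q))

      [2p^a]C[p^a]≡2 : + ((2 ℕ.* suc Q) C suc Q) ≡ + 2 [mod p ]
      [2p^a]C[p^a]≡2 = subst (_≡ + 2 [mod p ]) (trans (sym (ℤP.pos-+ X X)) (cong +_ (sym central≡X+X)))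
        (subst (+ X + + X ≡_[mod p ]) (cong (λ c → + c + + c) (nCn≡1 Q))
          (mod-+ X≡QCQ X≡QCQ))
        where
          X = (suc Q ℕ.+ Q) C Q
          X≡QCQ : + X ≡ + (Q C Q) [mod p ]
          X≡QCQ = [p^a+r]C[k]≡rC[k] Q (ℕP.n<1+n Q)
          central≡X+X : (2 ℕ.* suc Q) C suc Q ≡ X ℕ.+ X
          central≡X+X = begin
            (2 ℕ.* suc Q) C suc Q          ≡⟨ cong (_C suc Q) (shape Q) ⟩
            suc (suc Q ℕ.+ Q) C suc Q      ≡⟨ nCk+nC[k+1]≡[n+1]C[k+1] (suc Q ℕ.+ Q) Q ⟨
            X ℕ.+ (suc Q ℕ.+ Q) C suc Q    ≡⟨ cong (X ℕ.+_) (C-sym (suc Q) Q) ⟩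
            X ℕ.+ X                        ∎
            where open ≡-Reasoning
                  shape : ∀ Q → 2 ℕ.* suc Q ≡ suc (suc Q ℕ.+ Q)
                  shape = solve-∀

module PairedProducts where

  open ModularArithmetic
  open import Data.Integer using (_*_; _^_)

  module _ {x : ℕ} where

    product-─ : ∀ {L} (x∈L : x ∈ L) → product L ≡ x ℕ.* product (L ─ x∈L)
    product-─ (here refl)            = refl
    product-─ {y ∷ L} (there x∈L) = trans (cong (y ℕ.*_) (product-─ x∈L)) (x∙yz≈y∙xz y x _)

    length-─ : ∀ {L} (x∈L : x ∈ L) → length L ≡ suc (length (L ─ x∈L))
    length-─ (here refl)  = refl
    length-─ (there x∈L) = cong suc (length-─ x∈L)

    ∈-─⁻ : ∀ {L y} (x∈L : x ∈ L) → y ∈ L ─ x∈L → y ∈ L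
    ∈-─⁻ (here refl) y∈       = there y∈
    ∈-─⁻ (there x∈L) (here e) = here e
    ∈-─⁻ (there x∈L) (there y∈) = there (∈-─⁻ x∈L y∈)

    ∈-─⁺ : ∀ {L y} (x∈L : x ∈ L) → y ∈ L → y ≢ x → y ∈ L ─ x∈L
    ∈-─⁺ (here refl) (here y≡x) y≢x = contradiction y≡x y≢x
    ∈-─⁺ (here refl) (there y∈) _   = y∈
    ∈-─⁺ (there x∈L) (here e)  _    = here e
    ∈-─⁺ (there x∈L) (there y∈) y≢x = there (∈-─⁺ x∈L y∈ y≢x)

    All-─ : ∀ {P : ℕ → Set} {L} (x∈L : x ∈ L) → All P L → All P (L ─ x∈L)
    All-─ (here refl) (_ ∷ ps)  = ps
    All-─ (there x∈L) (p ∷ ps) = p ∷ All-─ x∈L ps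

    Unique-─ : ∀ {L} (x∈L : x ∈ L) → Unique L → Unique (L ─ x∈L)
    Unique-─ (here refl) (_ AllPairs.∷ u)  = u
    Unique-─ (there x∈L) (y≢ AllPairs.∷ u) = All-─ x∈L y≢ AllPairs.∷ Unique-─ x∈L u

    ∉-─ : ∀ {L} (x∈L : x ∈ L) → Unique L → x ∉ L ─ x∈L
    ∉-─ (here refl) (x≢ AllPairs.∷ _)      = All¬⇒¬Any x≢
    ∉-─ (there x∈L) (y≢ AllPairs.∷ _) (here refl) = All¬⇒¬Any y≢ x∈L
    ∉-─ (there x∈L) (_ AllPairs.∷ u) (there x∈)   = ∉-─ x∈L u x∈

  record Enumerates (P : ℕ → Set) (L : List ℕ) : Set where
    field
      unique   : Unique L
      sound    : ∀ {y} → y ∈ L → P y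
      complete : ∀ {y} → P y → y ∈ L

  open Enumerates

  module _ {P L} (enum : Enumerates P L) {x} (Px : P x) where

    private
      x∈L : x ∈ L
      x∈L = complete enum Px

    delete : List ℕ
    delete = L ─ x∈L

    enumerates-delete : Enumerates (λ y → P y × y ≢ x) delete
    enumerates-delete = record
      { unique   = Unique-─ x∈L (unique enum)
      ; sound    = λ y∈ → sound enum (∈-─⁻ x∈L y∈) , λ { refl → ∉-─ x∈L (unique enum) y∈ }
      ; complete = λ (Py , y≢x) → ∈-─⁺ x∈L (complete enum Py) y≢x
      }

    product-delete : product L ≡ x ℕ.* product delete
    product-delete = product-─ x∈L

    length-delete : length L ≡ suc (length delete)
    length-delete = length-─ x∈L

  module _ {P L} (enum : Enumerates P L) {x y} (Px : P x) (Py : P y) (y≢x : y ≢ x) where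

    private
      enum₁ : Enumerates (λ z → P z × z ≢ x) (delete enum Px)
      enum₁ = enumerates-delete enum Px

    delete₂ : List ℕ
    delete₂ = delete enum₁ (Py , y≢x)

    enumerates-delete₂ : Enumerates (λ z → (P z × z ≢ x) × z ≢ y) delete₂
    enumerates-delete₂ = enumerates-delete enum₁ (Py , y≢x)

    length-delete₂ : length L ≡ suc (suc (length delete₂))
    length-delete₂ = trans (length-delete enum Px) (cong suc (length-delete enum₁ (Py , y≢x)))

    product-delete₂ : + product L ≡ + x * + y * + product delete₂
    product-delete₂ = begin
      + product L                        ≡⟨ cong +_ (product-delete enum Px) ⟩
      + (x ℕ.* product (delete enum Px)) ≡⟨ cong (λ m → + (x ℕ.* m)) (product-delete enum₁ (Py , y≢x)) ⟩
      + (x ℕ.* (y ℕ.* product delete₂))  ≡⟨ cong +_ (ℕP.*-assoc x y (product delete₂)) ⟨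
      + (x ℕ.* y ℕ.* product delete₂)    ≡⟨ ℤP.pos-* (x ℕ.* y) (product delete₂) ⟩
      + (x ℕ.* y) * + product delete₂    ≡⟨ cong (_* + product delete₂) (ℤP.pos-* x y) ⟩
      + x * + y * + product delete₂      ∎
      where open ≡-Reasoning

  enumerates-applyUpTo-suc : ∀ n → Enumerates (λ y → 0 < y × y < suc n) (applyUpTo suc n)
  enumerates-applyUpTo-suc n = record
    { unique   = applyUpTo⁺₁ suc n (λ i<j _ → ℕP.<⇒≢ i<j ∘ ℕP.suc-injective)
    ; sound    = λ y∈ → case ∈-applyUpTo⁻ suc y∈ of λ { (i , i<n , refl) → s≤s z≤n , s≤s i<n }
    ; complete = λ { {suc i} (_ , s≤s i<n) → ∈-applyUpTo⁺ suc i<n }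
    }

  module _ (n : ℕ) (c : ℤ) (σ : ℕ → ℕ) where

    record PairedBy (P : ℕ → Set) : Set where
      field
        closed      : ∀ {x} → P x → P (σ x)
        involutive  : ∀ {x} → P x → σ (σ x) ≡ x
        no-fixpoint : ∀ {x} → P x → σ x ≢ x
        pair≡c      : ∀ {x} → P x → + x * + σ x ≡ c [mod n ]

    open PairedBy

    product-paired : ∀ k {P L} → Enumerates P L → length L ≡ 2 ℕ.* k → PairedBy P →
                     + product L ≡ c ^ k [mod n ]
    product-paired zero {L = []} _ _ _ = mod-refl
    product-paired (suc k) {P} {L@(x ∷ _)} enum length≡ paired =
      subst (_≡ c ^ suc k [mod n ]) (sym (product-delete₂ enum Px Pσx σx≢x))
        (mod-* (pair≡c paired Px) (product-paired k (enumerates-delete₂ enum Px Pσx σx≢x) length₂≡ paired₂))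
      where
        Px : P x
        Px = sound enum (here refl)
        Pσx : P (σ x)
        Pσx = closed paired Px
        σx≢x : σ x ≢ x
        σx≢x = no-fixpoint paired Px
        length₂≡ : length (delete₂ enum Px Pσx σx≢x) ≡ 2 ℕ.* k
        length₂≡ = ℕP.suc-injective (ℕP.suc-injective
          (trans (sym (length-delete₂ enum Px Pσx σx≢x)) (trans length≡ (ℕP.*-suc 2 k))))
        paired₂ : PairedBy (λ y → (P y × y ≢ x) × y ≢ σ x)
        paired₂ = record
          { closed      = λ { ((Py , y≢x) , y≢σx) →
              let σσy≡y = involutive paired Py in
              (closed paired Py , λ σy≡x → y≢σx (trans (sym σσy≡y) (cong σ σy≡x)))
              , λ σy≡σx → y≢x (trans (sym σσy≡y) (trans (cong σ σy≡σx) (involutive paired Px))) }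
          ; involutive  = λ y → involutive paired (proj₁ (proj₁ y))
          ; no-fixpoint = λ y → no-fixpoint paired (proj₁ (proj₁ y))
          ; pair≡c      = λ y → pair≡c paired (proj₁ (proj₁ y))
          }

module EulerCriterion where

  open ModularArithmetic
  open PairedProducts
  open import Data.Integer using (_+_; _*_; _-_; _^_)
  open ℤ-Solver using (solve-∀)

  halve : ∀ t n → 2 ℕ.* t ≡ suc (suc n) → ∃ λ k → t ≡ suc k × n ≡ 2 ℕ.* k
  halve (suc k) n 2t≡2+n = k , refl , ℕP.suc-injective (ℕP.suc-injective (trans (sym 2t≡2+n) (ℕP.*-suc 2 k)))

  module _ (t : ℕ) (p-prime : Prime (suc (2 ℕ.* t))) where

    private
      p : ℕ
      p = suc (2 ℕ.* t)

      instance
        p≢0 : ℕ.NonZero p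
        p≢0 = prime⇒nonZero p-prime

    InRange : ℕ → Set
    InRange x = 0 < x × x < p

    in-range⇒≢0 : ∀ {x} → InRange x → ¬ + x ≡ + 0 [mod p ]
    in-range⇒≢0 {suc x} (_ , x<p) x≡0 = ℕD.>⇒∤ x<p (≡0[mod]⇒∣ x≡0)

    inverse : ℕ → ℤ
    inverse x with coprime? x p
    ... | yes x⊥p = proj₁ (bézout⇒inverse (coprime-Bézout x⊥p))
    ... | no  _   = + 0

    inverse-correct : ∀ {x} → InRange x → + x * inverse x ≡ + 1 [mod p ]
    inverse-correct {x} (0<x , x<p) with coprime? x p
    ... | yes x⊥p = proj₂ (bézout⇒inverse (coprime-Bézout x⊥p))
    ... | no ¬x⊥p = ⊥-elim (¬x⊥p (Coprime.sym (prime⇒coprime p-prime {{ℕ.>-nonZero 0<x}} x<p)))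

    p∸x≡-x : ∀ {x} → x ≤ p → + (p ∸ x) ≡ - + x [mod p ]
    p∸x≡-x {x} x≤p = by-quotient (+ 1) (begin
      + (p ∸ x)            ≡⟨ ℤP.⊖-≥ x≤p ⟨
      p ℤ.⊖ x              ≡⟨ ℤP.m-n≡m⊖n p x ⟨
      + p - + x            ≡⟨ identity (+ p) (+ x) ⟩
      - + x + + 1 * + p    ∎)
      where open ≡-Reasoning
            identity : ∀ p x → p - x ≡ - x + + 1 * p
            identity = solve-∀

    [p∸x]²≡x² : ∀ {x} → x ≤ p → + (p ∸ x) * + (p ∸ x) ≡ + x * + x [mod p ]
    [p∸x]²≡x² {x} x≤p = subst (+ (p ∸ x) * + (p ∸ x) ≡_[mod p ]) (neg-square (+ x))
      (mod-* (p∸x≡-x x≤p) (p∸x≡-x x≤p))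
      where neg-square : ∀ x → - x * - x ≡ x * x
            neg-square = solve-∀

    x*[p∸x]≡-x² : ∀ {x} → x ≤ p → + x * + (p ∸ x) ≡ - (+ x * + x) [mod p ]
    x*[p∸x]≡-x² {x} x≤p = subst (+ x * + (p ∸ x) ≡_[mod p ]) (sym (ℤP.neg-distribʳ-* (+ x) (+ x)))
      (mod-*ˡ (+ x) (p∸x≡-x x≤p))

    p∸x-in-range : ∀ {x} → InRange x → InRange (p ∸ x)
    p∸x-in-range (0<x , x<p) = ℕP.m<n⇒0<n∸m x<p , ℕP.∸-monoʳ-< 0<x (ℕP.<⇒≤ x<p)

    p∸x≢x : ∀ {x} → InRange x → p ∸ x ≢ x
    p∸x≢x {x} (_ , x<p) p∸x≡x = ℕP.even≢odd x t (begin
      2 ℕ.* x          ≡⟨ cong (x ℕ.+_) (ℕP.+-identityʳ x) ⟩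
      x ℕ.+ x          ≡⟨ cong (ℕ._+ x) p∸x≡x ⟨
      p ∸ x ℕ.+ x      ≡⟨ ℕP.m∸n+n≡m (ℕP.<⇒≤ x<p) ⟩
      p                ∎)
      where open ≡-Reasoning

    square-roots : ∀ {x y} → InRange x → y < p → + y * + y ≡ + x * + x [mod p ] → y ≡ x ⊎ y ≡ p ∸ x
    square-roots {x} {y} (0<x , x<p) y<p y²≡x² =
      [ (λ y-x≡0 → inj₁ (residue-injective y<p x<p (x-y≡0⇒x≡y y-x≡0)))
      , (λ y+x≡0 → inj₂ (residue-injective y<p (ℕP.∸-monoʳ-< 0<x (ℕP.<⇒≤ x<p))
                     (mod-trans (x+y≡0⇒y≡-x (subst (_≡ + 0 [mod p ]) (ℤP.+-comm (+ y) (+ x)) y+x≡0))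
                                (mod-sym (p∸x≡-x (ℕP.<⇒≤ x<p))))))
      ]′ (mod-euclid p-prime (+ y - + x) (+ y + + x)
           (subst (_≡ + 0 [mod p ]) (factor (+ y) (+ x)) (x≡y⇒x-y≡0 y²≡x²)))
      where factor : ∀ y x → y * y - x * x ≡ (y - x) * (y + x)
            factor = solve-∀

    factorial : ℤ
    factorial = + product (applyUpTo suc (2 ℕ.* t))

    private
      range-enum : Enumerates InRange (applyUpTo suc (2 ℕ.* t))
      range-enum = enumerates-applyUpTo-suc (2 ℕ.* t)

    module _ {c : ℤ} (c≢0 : ¬ c ≡ + 0 [mod p ]) where

      partner : ℕ → ℕ
      partner x = proj₁ (residue p (inverse x * c))

      partner<p : ∀ x → partner x < p
      partner<p x = proj₁ (proj₂ (residue p (inverse x * c)))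

      partner-correct : ∀ {x} → InRange x → + x * + partner x ≡ c [mod p ]
      partner-correct {x} x∈ = mod-trans (mod-*ˡ (+ x) (mod-sym (proj₂ (proj₂ (residue p (inverse x * c))))))
        (subst₂ _≡_[mod p ] (ℤP.*-assoc (+ x) (inverse x) c) (ℤP.*-identityˡ c)
          (mod-* (inverse-correct x∈) (mod-refl {x = c})))

      partner-unique : ∀ {x y} → InRange x → y < p → + x * + y ≡ c [mod p ] → partner x ≡ y
      partner-unique {x} x∈ y<p xy≡c = residue-injective (partner<p x) y<p
        (mod-cancelˡ p-prime (+ x) (in-range⇒≢0 x∈) (mod-trans (partner-correct x∈) (mod-sym xy≡c)))

      partner-in-range : ∀ {x} → InRange x → InRange (partner x)
      partner-in-range {x} x∈ with partner x | partner-correct x∈ | partner<p x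
      ... | zero  | x*0≡c | _   = contradiction (mod-trans (mod-sym x*0≡c) (≡⇒≡[mod] (ℤP.*-zeroʳ (+ x)))) c≢0
      ... | suc _ | _     | σ<p = s≤s z≤n , σ<p

      partner-involutive : ∀ {x} → InRange x → partner (partner x) ≡ x
      partner-involutive {x} x∈ = partner-unique (partner-in-range x∈) (proj₂ x∈)
        (subst (_≡ c [mod p ]) (ℤP.*-comm (+ x) (+ partner x)) (partner-correct x∈))

      private
        paired-by-partner : ∀ {P : ℕ → Set} → (∀ {x} → P x → InRange x) → (∀ {x} → P x → P (partner x)) →
                            (∀ {x} → P x → partner x ≢ x) → PairedBy p c partner P
        paired-by-partner in-range closed no-fixpoint = record
          { closed      = closed
          ; involutive  = partner-involutive ∘ in-range
          ; no-fixpoint = no-fixpoint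
          ; pair≡c      = partner-correct ∘ in-range
          }

      partner-fixed : ∀ {x} → InRange x → + x * + x ≡ c [mod p ] → partner x ≡ x
      partner-fixed x∈ = partner-unique x∈ (proj₂ x∈)

      partner≡fixed⇒≡ : ∀ {y z} → InRange y → partner z ≡ z → partner y ≡ z → y ≡ z
      partner≡fixed⇒≡ y∈ σz≡z σy≡z = trans (sym (partner-involutive y∈)) (trans (cong partner σy≡z) σz≡z)

      paired-off-square-roots : ∀ {x₀} → InRange x₀ → + x₀ * + x₀ ≡ c [mod p ] →
                                PairedBy p c partner (λ y → (InRange y × y ≢ x₀) × y ≢ p ∸ x₀)
      paired-off-square-roots {x₀} x₀∈ x₀²≡c = paired-by-partner (proj₁ ∘ proj₁)
        (λ { ((y∈ , y≢x₀) , y≢x₁) →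
             (partner-in-range y∈ , y≢x₀ ∘ partner≡fixed⇒≡ y∈ σx₀≡x₀) , y≢x₁ ∘ partner≡fixed⇒≡ y∈ σx₁≡x₁ })
        (λ { {y} ((y∈ , y≢x₀) , y≢x₁) σy≡y → [ y≢x₀ , y≢x₁ ]′ (square-roots x₀∈ (proj₂ y∈)
             (mod-trans (subst (λ z → + y * + z ≡ c [mod p ]) σy≡y (partner-correct y∈)) (mod-sym x₀²≡c))) })
        where
          σx₀≡x₀ = partner-fixed x₀∈ x₀²≡c
          σx₁≡x₁ = partner-fixed (p∸x-in-range x₀∈) (mod-trans ([p∸x]²≡x² (ℕP.<⇒≤ (proj₂ x₀∈))) x₀²≡c)

      factorial-nonresidue : (∀ {y} → y < p → ¬ + y * + y ≡ c [mod p ]) → factorial ≡ c ^ t [mod p ]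
      factorial-nonresidue no-root = product-paired p c partner t range-enum (length-applyUpTo suc (2 ℕ.* t))
        (paired-by-partner id partner-in-range
          (λ {x} x∈ σx≡x → no-root (proj₂ x∈) (subst (λ y → + x * + y ≡ c [mod p ]) σx≡x (partner-correct x∈))))

      -- The pairing misses only the square roots x₀ and p − x₀ of c, whose product is −c.
      factorial-residue : ∀ {x₀} → x₀ < p → + x₀ * + x₀ ≡ c [mod p ] → factorial ≡ - c ^ t [mod p ]
      factorial-residue {zero}       _    0≡c = contradiction (mod-sym 0≡c) c≢0
      factorial-residue {x₀@(suc _)} x₀<p     = factorial-root (s≤s z≤n , x₀<p)
        where
          factorial-root : InRange x₀ → + x₀ * + x₀ ≡ c [mod p ] → factorial ≡ - c ^ t [mod p ]
          factorial-root x₀∈ x₀²≡c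
            with k , t≡1+k , length≡2k ← halve t _ (trans (sym (length-applyUpTo suc (2 ℕ.* t)))
                                           (length-delete₂ range-enum x₀∈ (p∸x-in-range x₀∈) (p∸x≢x x₀∈))) =
            subst (λ j → factorial ≡ - c ^ j [mod p ]) (sym t≡1+k)
              (subst₂ _≡_[mod p ] (sym (product-delete₂ range-enum x₀∈ (p∸x-in-range x₀∈) (p∸x≢x x₀∈)))
                                  (sym (ℤP.neg-distribˡ-* c (c ^ k)))
                (mod-* (mod-trans (x*[p∸x]≡-x² (ℕP.<⇒≤ x₀<p)) (mod-neg x₀²≡c))
                       (product-paired p c partner k (enumerates-delete₂ range-enum x₀∈ (p∸x-in-range x₀∈) (p∸x≢x x₀∈))
                         length≡2k (paired-off-square-roots x₀∈ x₀²≡c))))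

    private
      1<p : 1 < p
      1<p = ℕ.nonTrivial⇒n>1 p {{prime⇒nonTrivial p-prime}}

    wilson : factorial ≡ - + 1 [mod p ]
    wilson = subst (λ z → factorial ≡ - z [mod p ]) (ℤP.^-zeroˡ t)
      (factorial-residue (in-range⇒≢0 (s≤s z≤n , 1<p)) 1<p mod-refl)

    residue^t≡1 : ∀ {c x} → ¬ c ≡ + 0 [mod p ] → x < p → + x * + x ≡ c [mod p ] → c ^ t ≡ + 1 [mod p ]
    residue^t≡1 c≢0 x<p x²≡c = mod-neg-injective (mod-trans (mod-sym (factorial-residue c≢0 x<p x²≡c)) wilson)

    nonresidue^t≡-1 : ∀ {c} → ¬ c ≡ + 0 [mod p ] → (∀ {y} → y < p → ¬ + y * + y ≡ c [mod p ]) →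
                      c ^ t ≡ - + 1 [mod p ]
    nonresidue^t≡-1 c≢0 no-root = mod-trans (mod-sym (factorial-nonresidue c≢0 no-root)) wilson

    square^t≡1 : ∀ {z} → ¬ z ≡ + 0 [mod p ] → (z * z) ^ t ≡ + 1 [mod p ]
    square^t≡1 {z} z≢0 with residue p z
    ... | r , r<p , z≡r = residue^t≡1 (mod-*-≢0 p-prime z≢0 z≢0) r<p (mod-sym (mod-* z≡r z≡r))

    private
      does⇒ : ∀ {A : Set} (a? : Dec A) → T (does a?) → A
      does⇒ (yes a) _ = a

      ⇒does : ∀ {A : Set} (a? : Dec A) → A → T (does a?)
      ⇒does (yes _) _ = tt
      ⇒does (no ¬a) a = ¬a a

      T-any⇒∃ : ∀ (f : ℕ → Bool) xs → T (any f xs) → ∃ λ x → x ∈ xs × T (f x)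
      T-any⇒∃ f xs = find ∘ any⁻ f xs

      is-root : ℤ → ℕ → Bool
      is-root c x = does (p ∣? ∣ (+ x) * (+ x) - c ∣)

    euler-criterion : ∀ {c} → ¬ c ≡ + 0 [mod p ] → c ^ t ≡ legendre c p [mod p ]
    euler-criterion {c} c≢0 with p ∣? ∣ c ∣
    ... | yes p∣c = contradiction (∣⇒≡0[mod] p∣c) c≢0
    ... | no  _   with any (is-root c) (upTo p) in has-root
    ...   | true  with x , x∈ , x-is-root ← T-any⇒∃ (is-root c) (upTo p) (subst T (sym has-root) _) =
      residue^t≡1 c≢0 (∈-upTo⁻ x∈) (x-y≡0⇒x≡y (∣⇒≡0[mod] (does⇒ (p ∣? ∣ + x * + x - c ∣) x-is-root)))
    ...   | false = nonresidue^t≡-1 c≢0 λ {y} y<p y²≡c →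
      subst T has-root (any⁺ (is-root c) (lose (∈-upTo⁺ y<p)
        (⇒does (p ∣? ∣ + y * + y - c ∣) (≡0[mod]⇒∣ (x≡y⇒x-y≡0 y²≡c)))))

    legendre-squared : ∀ {c} → ¬ c ≡ + 0 [mod p ] → legendre c p * legendre c p ≡ + 1
    legendre-squared {c} c≢0 with p ∣? ∣ c ∣
    ... | yes p∣c = contradiction (∣⇒≡0[mod] p∣c) c≢0
    ... | no  _   with any (is-root c) (upTo p)
    ...   | true  = refl
    ...   | false = refl

module JacobiSymbolOfPrimePowers where

  open import Data.Nat using (_^_)

  powℤ≡^ : ∀ x k → powℤ x k ≡ x ℤ.^ k
  powℤ≡^ x zero    = refl
  powℤ≡^ x (suc k) = cong (x ℤ.*_) (powℤ≡^ x k)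

  n<m^n : ∀ {m} → 1 < m → ∀ n → n < m ^ n
  n<m^n 1<m zero    = s≤s z≤n
  n<m^n {m} 1<m (suc n) = begin-strict
    suc n               ≤⟨ n<m^n 1<m n ⟩
    m ^ n               <⟨ ℕP.m<m+n (m ^ n) (ℕP.m^n>0 m {{nonZero}} n) ⟩
    m ^ n ℕ.+ m ^ n     ≡⟨ cong (m ^ n ℕ.+_) (ℕP.+-identityʳ (m ^ n)) ⟨
    2 ℕ.* m ^ n         ≤⟨ ℕP.*-monoˡ-≤ (m ^ n) 1<m ⟩
    m ℕ.* m ^ n         ∎
    where open ℕP.≤-Reasoning
          nonZero = ℕ.>-nonZero (ℕP.<-trans (s≤s z≤n) 1<m)

  valFuel-∤ : ∀ f q n → ¬ q ∣ n → valFuel f q n ≡ 0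
  valFuel-∤ zero    q                   n       _   = refl
  valFuel-∤ (suc f) zero                n       _   = refl
  valFuel-∤ (suc f) (suc zero)          n       _   = refl
  valFuel-∤ (suc f) (suc (suc q))       zero    _   = refl
  valFuel-∤ (suc f) q@(suc (suc _))     (suc n) q∤n with q ∣? suc n
  ... | yes q∣n = contradiction q∣n q∤n
  ... | no  _   = refl

  valFuel-^ : ∀ q f b n → n ≡ suc (suc q) ^ b → b ≤ f → valFuel f (suc (suc q)) n ≡ b
  valFuel-^ q f zero n refl _ = valFuel-∤ f (suc (suc q)) 1 (λ q∣1 → contradiction (ℕD.∣1⇒≡1 q∣1) λ ())
  valFuel-^ q (suc f) (suc b) zero 0≡q^b _ = contradiction 0≡q^b (ℕP.<⇒≢ (ℕP.m^n>0 (suc (suc q)) (suc b)))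
  valFuel-^ q (suc f) (suc b) (suc n) n≡q^b (s≤s b≤f) with suc (suc q) ∣? suc n
  ... | no  q∤n = contradiction (subst (suc (suc q) ∣_) (sym n≡q^b) (ℕD.m∣m*n (suc (suc q) ^ b))) q∤n
  ... | yes q∣n = cong suc (valFuel-^ q f b (quotient q∣n) quotient≡q^b b≤f)
    where
      quotient≡q^b : quotient q∣n ≡ suc (suc q) ^ b
      quotient≡q^b = ℕP.*-cancelʳ-≡ (quotient q∣n) (suc (suc q) ^ b) (suc (suc q))
        (trans (sym (ℕD._∣_.equality q∣n)) (trans n≡q^b (ℕP.*-comm (suc (suc q)) (suc (suc q) ^ b))))

  val-p^b : ∀ {p} → Prime p → ∀ b → val p (p ^ b) ≡ b
  val-p^b {zero}          p-prime _ with () ← prime⇒nonTrivial p-prime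
  val-p^b {suc zero}      p-prime _ with () ← prime⇒nonTrivial p-prime
  val-p^b {suc (suc q)}   _       b = valFuel-^ q (suc (suc q) ^ b) b _ refl (ℕP.<⇒≤ (n<m^n (s≤s (s≤s z≤n)) b))

  module _ {p : ℕ} (p-prime : Prime p) where

    private
      prime∣p⇒≡p : ∀ {q} → Prime q → q ∣ p → q ≡ p
      prime∣p⇒≡p q-prime q∣p with prime⇒irreducible p-prime q∣p
      ... | inj₂ q≡p  = q≡p
      ... | inj₁ refl with () ← prime⇒nonTrivial q-prime

    prime∤p^b : ∀ {q} → Prime q → q ≢ p → ∀ b → ¬ q ∣ p ^ b
    prime∤p^b q-prime q≢p zero q∣1 with () ← subst ℕ.NonTrivial (ℕD.∣1⇒≡1 q∣1) (prime⇒nonTrivial q-prime)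
    prime∤p^b {q} q-prime q≢p (suc b) q∣p^b with euclidsLemma p (p ^ b) q-prime q∣p^b
    ... | inj₁ q∣p   = q≢p (prime∣p⇒≡p q-prime q∣p)
    ... | inj₂ q∣p^b = prime∤p^b q-prime q≢p b q∣p^b

    module _ (A : ℤ) (a : ℕ) where

      private
        drop-factor : ∀ {q} → Prime q → q ≢ p → ∀ r →
                      powℤ (legendre A q) (val q (p ^ a)) ℤ.* r ≡ r
        drop-factor {q} q-prime q≢p r =
          trans (cong (λ v → powℤ (legendre A q) v ℤ.* r) (valFuel-∤ (p ^ a) q (p ^ a) (prime∤p^b q-prime q≢p a)))
                (ℤP.*-identityˡ r)

      jacobiUpTo-below : ∀ {k} → k < p → jacobiUpTo A (p ^ a) k ≡ + 1
      jacobiUpTo-below {zero}  _   = refl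
      jacobiUpTo-below {suc k} k<p with prime? (suc k)
      ... | yes q-prime = trans (drop-factor q-prime (ℕP.<⇒≢ k<p) _) (jacobiUpTo-below (ℕP.<-trans (ℕP.n<1+n k) k<p))
      ... | no  _       = jacobiUpTo-below (ℕP.<-trans (ℕP.n<1+n k) k<p)

      jacobiUpTo-above : ∀ {k} → p ≤ k → jacobiUpTo A (p ^ a) k ≡ powℤ (legendre A p) a
      jacobiUpTo-above {zero}  p≤0 with () ← subst ℕ.NonTrivial (ℕP.n≤0⇒n≡0 p≤0) (prime⇒nonTrivial p-prime)
      jacobiUpTo-above {suc k} p≤k with prime? (suc k) | suc k ℕP.≟ p
      ... | yes _       | yes refl =
        trans (cong₂ (λ v r → powℤ (legendre A (suc k)) v ℤ.* r) (val-p^b p-prime a) (jacobiUpTo-below (ℕP.n<1+n k)))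
              (ℤP.*-identityʳ _)
      ... | no ¬prime   | yes refl = contradiction p-prime ¬prime
      ... | yes q-prime | no  k≢p  =
        trans (drop-factor q-prime k≢p _) (jacobiUpTo-above (ℕP.≤-pred (ℕP.≤∧≢⇒< p≤k (k≢p ∘ sym))))
      ... | no  _       | no  k≢p  = jacobiUpTo-above (ℕP.≤-pred (ℕP.≤∧≢⇒< p≤k (k≢p ∘ sym)))

      jacobi-prime-power : 1 ≤ a → jacobi A (p ^ a) ≡ legendre A p ℤ.^ a
      jacobi-prime-power 1≤a = trans (jacobiUpTo-above p≤p^a) (powℤ≡^ (legendre A p) a)
        where p≤p^a : p ≤ p ^ a
              p≤p^a = subst (_≤ p ^ a) (ℕP.^-identityʳ p) (ℕP.^-monoʳ-≤ p {{prime⇒nonZero p-prime}} 1≤a)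

module Telescoping where

  open ModularArithmetic using (p^e∣x*d⇒p^e∣x)
  open CentralBinomial using (central-C-step)
  open import Data.Rational using (_+_; _*_; _-_)
  open RingSolver using (solve-∀)

  ℚ-ring : ACR.AlmostCommutativeRing 0ℓ 0ℓ
  ℚ-ring = ACR.fromCommutativeRing ℚP.+-*-commutativeRing is-zero
    where is-zero : ∀ x → Maybe (0ℚ ≡ x)
          is-zero x with x ℚP.≟ 0ℚ
          ... | yes x≡0 = just (sym x≡0)
          ... | no  _   = nothing

  private
    toℚᵘ-ℤtoℚ : ∀ z → toℚᵘ (ℤtoℚ z) ℚᵘ.≃ mkℚᵘ z 0
    toℚᵘ-ℤtoℚ z = ℚP.toℚᵘ-fromℚᵘ (mkℚᵘ z 0)

  ℤtoℚ-* : ∀ x y → ℤtoℚ (x ℤ.* y) ≡ ℤtoℚ x * ℤtoℚ y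
  ℤtoℚ-* x y = ℚP.toℚᵘ-injective (ℚᵘP.≃-trans (toℚᵘ-ℤtoℚ (x ℤ.* y)) (ℚᵘP.≃-sym
    (ℚᵘP.≃-trans (ℚP.toℚᵘ-homo-* (ℤtoℚ x) (ℤtoℚ y)) (ℚᵘP.*-cong (toℚᵘ-ℤtoℚ x) (toℚᵘ-ℤtoℚ y)))))

  ℤtoℚ-+ : ∀ x y → ℤtoℚ (x ℤ.+ y) ≡ ℤtoℚ x + ℤtoℚ y
  ℤtoℚ-+ x y = ℚP.toℚᵘ-injective (ℚᵘP.≃-trans (toℚᵘ-ℤtoℚ (x ℤ.+ y)) (ℚᵘP.≃-sym
    (ℚᵘP.≃-trans (ℚP.toℚᵘ-homo-+ (ℤtoℚ x) (ℤtoℚ y))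
      (ℚᵘP.≃-trans (ℚᵘP.+-cong (toℚᵘ-ℤtoℚ x) (toℚᵘ-ℤtoℚ y)) (*≡* (identity x y))))))
    where identity : ∀ x y → (x ℤ.* + 1 ℤ.+ y ℤ.* + 1) ℤ.* + 1 ≡ (x ℤ.+ y) ℤ.* + 1
          identity = ℤ-Solver.solve-∀

  ℤtoℚ-neg : ∀ x → ℤtoℚ (ℤ.- x) ≡ ℚ.- ℤtoℚ x
  ℤtoℚ-neg x = ℚP.toℚᵘ-injective (ℚᵘP.≃-trans (toℚᵘ-ℤtoℚ (ℤ.- x)) (ℚᵘP.≃-sym
    (ℚᵘP.≃-trans (ℚP.toℚᵘ-homo‿- (ℤtoℚ x)) (ℚᵘP.-‿cong (toℚᵘ-ℤtoℚ x)))))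

  ℤtoℚ-- : ∀ x y → ℤtoℚ (x ℤ.- y) ≡ ℤtoℚ x - ℤtoℚ y
  ℤtoℚ-- x y = trans (ℤtoℚ-+ x (ℤ.- y)) (cong (λ q → ℤtoℚ x + q) (ℤtoℚ-neg y))

  ℕtoℚ-* : ∀ a b → ℕtoℚ (a ℕ.* b) ≡ ℕtoℚ a * ℕtoℚ b
  ℕtoℚ-* a b = trans (cong ℤtoℚ (ℤP.pos-* a b)) (ℤtoℚ-* (+ a) (+ b))

  ℕtoℚ-+ : ∀ a b → ℕtoℚ (a ℕ.+ b) ≡ ℕtoℚ a + ℕtoℚ b
  ℕtoℚ-+ a b = trans (cong ℤtoℚ (ℤP.pos-+ a b)) (ℤtoℚ-+ (+ a) (+ b))

  ℤtoℚ-^ : ∀ m n → ℤtoℚ (m ℤ.^ n) ≡ powℚ (ℤtoℚ m) n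
  ℤtoℚ-^ m zero    = refl
  ℤtoℚ-^ m (suc n) = trans (ℤtoℚ-* m (m ℤ.^ n)) (cong (ℤtoℚ m *_) (ℤtoℚ-^ m n))

  ½ : ℚ
  ½ = + 1 ℚ./ 2

  /2≡*½ : ∀ z → z ℚ./ 2 ≡ ℤtoℚ z * ½
  /2≡*½ z = ℚP.toℚᵘ-injective (ℚᵘP.≃-trans (ℚP.toℚᵘ-fromℚᵘ (mkℚᵘ z 1)) (ℚᵘP.≃-sym
    (ℚᵘP.≃-trans (ℚP.toℚᵘ-homo-* (ℤtoℚ z) ½)
      (ℚᵘP.≃-trans (ℚᵘP.*-cong (toℚᵘ-ℤtoℚ z) (ℚP.toℚᵘ-fromℚᵘ (mkℚᵘ (+ 1) 1))) (*≡* (identity z))))))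
    where identity : ∀ z → (z ℤ.* + 1) ℤ.* + 2 ≡ z ℤ.* + 2
          identity = ℤ-Solver.solve-∀

  ℤtoℚ*recipℤ : ∀ m → m ≢ + 0 → ℤtoℚ m * recipℤ m ≡ 1ℚ
  ℤtoℚ*recipℤ (+ zero)  m≢0 = contradiction refl m≢0
  ℤtoℚ*recipℤ (+ suc n) _   = ℚP.toℚᵘ-injective (ℚᵘP.≃-trans (ℚP.toℚᵘ-homo-* (ℤtoℚ (+ suc n)) (recipℤ (+ suc n)))
    (ℚᵘP.≃-trans (ℚᵘP.*-cong (toℚᵘ-ℤtoℚ (+ suc n)) (ℚP.toℚᵘ-fromℚᵘ (mkℚᵘ (+ 1) n)))
      (*≡* (trans (identity (+ suc n)) (cong (λ k → + 1 ℤ.* + suc k) (sym (ℕP.+-identityʳ n)))))))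
    where identity : ∀ a → a ℤ.* + 1 ℤ.* + 1 ≡ + 1 ℤ.* a
          identity = ℤ-Solver.solve-∀
  ℤtoℚ*recipℤ -[1+ n ]  _   = ℚP.toℚᵘ-injective (ℚᵘP.≃-trans (ℚP.toℚᵘ-homo-* (ℤtoℚ -[1+ n ]) (recipℤ -[1+ n ]))
    (ℚᵘP.≃-trans (ℚᵘP.*-cong (toℚᵘ-ℤtoℚ -[1+ n ]) (ℚP.toℚᵘ-fromℚᵘ (mkℚᵘ -[1+ 0 ] n)))
      (*≡* (trans (identity (+ suc n)) (cong (λ k → + 1 ℤ.* + suc k) (sym (ℕP.+-identityʳ n)))))))
    where identity : ∀ a → (ℤ.- a) ℤ.* (ℤ.- (+ 1)) ℤ.* + 1 ≡ + 1 ℤ.* a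
          identity = ℤ-Solver.solve-∀

  -- The reduced denominator of x − y divides d, so it is prime to p, and p^e divides the numerator.
  CongQ-intro : ∀ {p} → Prime p → ∀ e x y (d u : ℤ) → ℤtoℚ d * (x - y) ≡ ℤtoℚ u →
                ¬ p ∣ ∣ d ∣ → p ℕ.^ e ∣ ∣ u ∣ → CongQ p e x y
  CongQ-intro {p} p-prime e x y d u d*[x-y]≡u p∤d p^e∣u with x - y
  ... | mkℚ n k n⊥1+k = p∤1+k , p^e∣n
    where
      ∣d∣*∣n∣≡∣u∣*[1+k] : ∣ d ∣ ℕ.* ∣ n ∣ ≡ ∣ u ∣ ℕ.* suc k
      ∣d∣*∣n∣≡∣u∣*[1+k] with ℚᵘP.≃-trans (ℚᵘP.*-cong (ℚᵘP.≃-sym (toℚᵘ-ℤtoℚ d)) (ℚᵘP.≃-refl {toℚᵘ (mkℚ n k n⊥1+k)}))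
                               (ℚᵘP.≃-trans (ℚᵘP.≃-sym (ℚP.toℚᵘ-homo-* (ℤtoℚ d) (mkℚ n k n⊥1+k)))
                                 (ℚᵘP.≃-trans (ℚᵘP.≃-reflexive (cong toℚᵘ d*[x-y]≡u)) (toℚᵘ-ℤtoℚ u)))
      ... | *≡* dn*1≡u*[1+k] = begin
        ∣ d ∣ ℕ.* ∣ n ∣             ≡⟨ ℤP.abs-* d n ⟨
        ∣ d ℤ.* n ∣                   ≡⟨ cong ∣_∣ (ℤP.*-identityʳ (d ℤ.* n)) ⟨
        ∣ d ℤ.* n ℤ.* + 1 ∣           ≡⟨ cong ∣_∣ dn*1≡u*[1+k] ⟩
        ∣ u ℤ.* + suc (k ℕ.+ 0) ∣     ≡⟨ ℤP.abs-* u (+ suc (k ℕ.+ 0)) ⟩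
        ∣ u ∣ ℕ.* suc (k ℕ.+ 0)       ≡⟨ cong (λ j → ∣ u ∣ ℕ.* suc j) (ℕP.+-identityʳ k) ⟩
        ∣ u ∣ ℕ.* suc k               ∎
        where open ≡-Reasoning
      1+k∣d : suc k ∣ ∣ d ∣
      1+k∣d = coprime-divisor (Coprime.sym (Coprime.recompute n⊥1+k))
        (subst (suc k ∣_) (trans (sym ∣d∣*∣n∣≡∣u∣*[1+k]) (ℕP.*-comm ∣ d ∣ ∣ n ∣)) (ℕD.n∣m*n ∣ u ∣))
      p∤1+k : ¬ p ∣ suc k
      p∤1+k p∣1+k = p∤d (ℕD.∣-trans p∣1+k 1+k∣d)
      p^e∣n : p ℕ.^ e ∣ ∣ n ∣
      p^e∣n = p^e∣x*d⇒p^e∣x p-prime e ∣ n ∣ ∣ d ∣ p∤d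
        (subst (p ℕ.^ e ∣_) (trans (sym ∣d∣*∣n∣≡∣u∣*[1+k]) (ℕP.*-comm ∣ d ∣ ∣ n ∣)) (ℕD.∣-trans p^e∣u (ℕD.m∣m*n (suc k))))

  telescope : ∀ (c : ℚ) (g h D : ℕ → ℚ) → D 0 ≡ 0ℚ → (∀ k → c * g k ≡ h k - (D (suc k) - D k)) →
              ∀ N → c * sumTo N g ≡ sumTo N h - D (suc N)
  telescope c g h D D₀≡0 step zero = begin
    c * g 0                 ≡⟨ step 0 ⟩
    h 0 - (D 1 - D 0)       ≡⟨ cong (λ d → h 0 - (D 1 - d)) D₀≡0 ⟩
    h 0 - (D 1 - 0ℚ)        ≡⟨ identity (h 0) (D 1) ⟩
    h 0 - D 1               ∎
    where open ≡-Reasoning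
          identity : ∀ h d → h - (d - 0ℚ) ≡ h - d
          identity = solve-∀ ℚ-ring
  telescope c g h D D₀≡0 step (suc N) = begin
    c * (sumTo N g + g (suc N))
      ≡⟨ ℚP.*-distribˡ-+ c (sumTo N g) (g (suc N)) ⟩
    c * sumTo N g + c * g (suc N)
      ≡⟨ cong₂ _+_ (telescope c g h D D₀≡0 step N) (step (suc N)) ⟩
    (sumTo N h - D (suc N)) + (h (suc N) - (D (suc (suc N)) - D (suc N)))
      ≡⟨ identity (sumTo N h) (h (suc N)) (D (suc N)) (D (suc (suc N))) ⟩
    sumTo N h + h (suc N) - D (suc (suc N))
      ∎
    where open ≡-Reasoning
          identity : ∀ s h d d′ → (s - d) + (h - (d′ - d)) ≡ s + h - d′
          identity = solve-∀ ℚ-ring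

  module _ (m : ℤ) where

    private
      M r t : ℚ
      M = ℤtoℚ m
      r = recipℤ m
      t = ℕtoℚ 2

      ½t≡1 : ½ * t ≡ 1ℚ
      ½t≡1 = refl

    f₀ f₁ : ℕ → ℚ
    f₀ k = ℕtoℚ ((2 ℕ.* k) C k) * powℚ r k
    f₁ k = ℕtoℚ (k ℕ.* ((2 ℕ.* k) C k)) * powℚ r k

    c : ℚ
    c = (m ℤ.- + 4) ℚ./ 2

    D : ℕ → ℚ
    D k = M * ½ * f₁ k

    private
      ℕtoℚ-central : ∀ k → ℕtoℚ (suc k ℕ.* ((2 ℕ.* suc k) C suc k)) ≡ t * (1ℚ + t * ℕtoℚ k) * ℕtoℚ ((2 ℕ.* k) C k)
      ℕtoℚ-central k = begin
        ℕtoℚ (suc k ℕ.* ((2 ℕ.* suc k) C suc k))       ≡⟨ cong ℕtoℚ (central-C-step k) ⟩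
        ℕtoℚ (2 ℕ.* suc (2 ℕ.* k) ℕ.* Cₖ)              ≡⟨ ℕtoℚ-* (2 ℕ.* suc (2 ℕ.* k)) Cₖ ⟩
        ℕtoℚ (2 ℕ.* suc (2 ℕ.* k)) * ℕtoℚ Cₖ            ≡⟨ cong (_* ℕtoℚ Cₖ) (ℕtoℚ-* 2 (suc (2 ℕ.* k))) ⟩
        t * ℕtoℚ (1 ℕ.+ 2 ℕ.* k) * ℕtoℚ Cₖ              ≡⟨ cong (λ q → t * q * ℕtoℚ Cₖ) (ℕtoℚ-+ 1 (2 ℕ.* k)) ⟩
        t * (1ℚ + ℕtoℚ (2 ℕ.* k)) * ℕtoℚ Cₖ             ≡⟨ cong (λ q → t * (1ℚ + q) * ℕtoℚ Cₖ) (ℕtoℚ-* 2 k) ⟩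
        t * (1ℚ + t * ℕtoℚ k) * ℕtoℚ Cₖ                 ∎
        where open ≡-Reasoning
              Cₖ = (2 ℕ.* k) C k

    module _ (m≢0 : m ≢ + 0) where

      private
        Mr≡1 : M * r ≡ 1ℚ
        Mr≡1 = ℤtoℚ*recipℤ m m≢0

        M^N*r^N≡1 : ∀ N → powℚ M N * powℚ r N ≡ 1ℚ
        M^N*r^N≡1 zero    = refl
        M^N*r^N≡1 (suc N) = begin
          M * powℚ M N * (r * powℚ r N)      ≡⟨ interchange M (powℚ M N) r (powℚ r N) ⟩
          (M * r) * (powℚ M N * powℚ r N)    ≡⟨ cong₂ _*_ Mr≡1 (M^N*r^N≡1 N) ⟩
          1ℚ                                 ∎
          where open ≡-Reasoning
                interchange : ∀ a b c d → a * b * (c * d) ≡ (a * c) * (b * d)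
                interchange = solve-∀ ℚ-ring

      D-step : ∀ k → D (suc k) ≡ f₀ k + t * f₁ k
      D-step k = begin
        M * ½ * (ℕtoℚ (suc k ℕ.* ((2 ℕ.* suc k) C suc k)) * (r * R))
          ≡⟨ cong (λ q → M * ½ * (q * (r * R))) (ℕtoℚ-central k) ⟩
        M * ½ * (t * (1ℚ + t * K) * B * (r * R))
          ≡⟨ regroup M ½ t K B r R ⟩
        (M * r) * (½ * t) * (B * R + t * (K * B * R))
          ≡⟨ cong₂ (λ u v → u * v * (B * R + t * (K * B * R))) Mr≡1 ½t≡1 ⟩
        1ℚ * 1ℚ * (B * R + t * (K * B * R))
          ≡⟨ unit (B * R + t * (K * B * R)) ⟩
        B * R + t * (K * B * R)
          ≡⟨ cong (λ q → B * R + t * (q * R)) (ℕtoℚ-* k ((2 ℕ.* k) C k)) ⟨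
        f₀ k + t * f₁ k
          ∎
        where
          open ≡-Reasoning
          K = ℕtoℚ k
          B = ℕtoℚ ((2 ℕ.* k) C k)
          R = powℚ r k
          regroup : ∀ M h t K B r R → M * h * (t * (1ℚ + t * K) * B * (r * R)) ≡ (M * r) * (h * t) * (B * R + t * (K * B * R))
          regroup = solve-∀ ℚ-ring
          unit : ∀ x → 1ℚ * 1ℚ * x ≡ x
          unit = solve-∀ ℚ-ring

      telescoping-step : ∀ k → c * f₁ k ≡ f₀ k - (D (suc k) - D k)
      telescoping-step k = begin
        c * F                                      ≡⟨ cong (_* F) c≡ ⟩
        (M - t * t) * ½ * F                        ≡⟨ identity M t ½ F (f₀ k) ⟩
        f₀ k - ((f₀ k + t * ((½ * t) * F)) - D k)  ≡⟨ cong (λ u → f₀ k - ((f₀ k + t * (u * F)) - D k)) ½t≡1 ⟩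
        f₀ k - ((f₀ k + t * (1ℚ * F)) - D k)       ≡⟨ cong (λ u → f₀ k - ((f₀ k + t * u) - D k)) (ℚP.*-identityˡ F) ⟩
        f₀ k - ((f₀ k + t * F) - D k)              ≡⟨ cong (λ u → f₀ k - (u - D k)) (D-step k) ⟨
        f₀ k - (D (suc k) - D k)                   ∎
        where
          open ≡-Reasoning
          F = f₁ k
          c≡ : c ≡ (M - t * t) * ½
          c≡ = trans (/2≡*½ (m ℤ.- + 4)) (cong (_* ½) (ℤtoℚ-- m (+ 4)))
          identity : ∀ M t h F f → (M - t * t) * h * F ≡ f - ((f + t * ((h * t) * F)) - M * h * F)
          identity = solve-∀ ℚ-ring

      telescoped : ∀ N → c * sumTo N f₁ ≡ sumTo N f₀ - D (suc N)
      telescoped = telescope c f₁ f₀ D (ℚP.*-zeroʳ (M * ½)) telescoping-step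

      scaled-difference : ∀ N T →
        ℤtoℚ (+ 2 ℤ.* m ℤ.^ N) * (c * sumTo N f₁ - (sumTo N f₀ - ℤtoℚ T))
          ≡ ℤtoℚ (+ 2 ℤ.* m ℤ.^ N ℤ.* T ℤ.- + (suc N ℕ.* ((2 ℕ.* suc N) C suc N)))
      scaled-difference N T = begin
        ℤtoℚ (+ 2 ℤ.* m ℤ.^ N) * (c * sumTo N f₁ - (S₀ - T′))
          ≡⟨ cong₂ (λ u v → u * (v - (S₀ - T′))) scale≡ (telescoped N) ⟩
        t * Mᴺ * ((S₀ - M * ½ * (K * (r * Rᴺ))) - (S₀ - T′))
          ≡⟨ identity t Mᴺ S₀ M ½ K r Rᴺ T′ ⟩
        t * Mᴺ * T′ - (½ * t) * (M * r) * (Mᴺ * Rᴺ) * K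
          ≡⟨ cong₂ (λ u v → t * Mᴺ * T′ - u * v * (Mᴺ * Rᴺ) * K) ½t≡1 Mr≡1 ⟩
        t * Mᴺ * T′ - 1ℚ * 1ℚ * (Mᴺ * Rᴺ) * K
          ≡⟨ cong (λ u → t * Mᴺ * T′ - 1ℚ * 1ℚ * u * K) (M^N*r^N≡1 N) ⟩
        t * Mᴺ * T′ - 1ℚ * 1ℚ * 1ℚ * K
          ≡⟨ unit (t * Mᴺ * T′) K ⟩
        t * Mᴺ * T′ - K
          ≡⟨ cong (_- K) (trans (ℤtoℚ-* (+ 2 ℤ.* m ℤ.^ N) T) (cong (_* T′) scale≡)) ⟨
        ℤtoℚ (+ 2 ℤ.* m ℤ.^ N ℤ.* T) - K
          ≡⟨ ℤtoℚ-- (+ 2 ℤ.* m ℤ.^ N ℤ.* T) (+ (suc N ℕ.* ((2 ℕ.* suc N) C suc N))) ⟨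
        ℤtoℚ (+ 2 ℤ.* m ℤ.^ N ℤ.* T ℤ.- + (suc N ℕ.* ((2 ℕ.* suc N) C suc N)))
          ∎
        where
          open ≡-Reasoning
          S₀ = sumTo N f₀
          T′ = ℤtoℚ T
          Mᴺ = powℚ M N
          Rᴺ = powℚ r N
          K = ℕtoℚ (suc N ℕ.* ((2 ℕ.* suc N) C suc N))
          scale≡ : ℤtoℚ (+ 2 ℤ.* m ℤ.^ N) ≡ t * Mᴺ
          scale≡ = trans (ℤtoℚ-* (+ 2) (m ℤ.^ N)) (cong (t *_) (ℤtoℚ-^ m N))
          identity : ∀ t Mᴺ S₀ M h K r Rᴺ T →
                     t * Mᴺ * ((S₀ - M * h * (K * (r * Rᴺ))) - (S₀ - T)) ≡ t * Mᴺ * T - (h * t) * (M * r) * (Mᴺ * Rᴺ) * K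
          identity = solve-∀ ℚ-ring
          unit : ∀ x K → x - 1ℚ * 1ℚ * 1ℚ * K ≡ x - K
          unit = solve-∀ ℚ-ring

      sum-congruence : ∀ {p} → Prime p → ∀ e N T → ¬ p ∣ ∣ + 2 ℤ.* m ℤ.^ N ∣ →
                       p ℕ.^ e ∣ ∣ + 2 ℤ.* m ℤ.^ N ℤ.* T ℤ.- + (suc N ℕ.* ((2 ℕ.* suc N) C suc N)) ∣ →
                       CongQ p e (c * sumTo N f₁) (sumTo N f₀ - ℤtoℚ T)
      sum-congruence p-prime e N T = CongQ-intro p-prime e (c * sumTo N f₁) (sumTo N f₀ - ℤtoℚ T)
        (+ 2 ℤ.* m ℤ.^ N) (+ 2 ℤ.* m ℤ.^ N ℤ.* T ℤ.- + (suc N ℕ.* ((2 ℕ.* suc N) C suc N))) (scaled-difference N T)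

module CentralBinomialSums where

  open ModularArithmetic
  open CentralBinomial
  open BinomialsModuloPrimePowers
  open EulerCriterion
  open JacobiSymbolOfPrimePowers
  open Telescoping

  odd⇒2t+1 : ∀ p → ¬ 2 ∣ p → ∃ λ t → p ≡ suc (2 ℕ.* t)
  odd⇒2t+1 p 2∤p with p ℕ.% 2 | m≡m%n+[m/n]*n p 2 | m%n<n p 2
  ... | zero        | p≡2q   | _ = contradiction (divides (p ℕ./ 2) p≡2q) 2∤p
  ... | suc zero    | p≡1+2q | _ = p ℕ./ 2 , trans p≡1+2q (cong suc (ℕP.*-comm (p ℕ./ 2) 2))
  ... | suc (suc _) | _      | s≤s (s≤s ())

  geometric : ℕ → ℕ → ℕ
  geometric q zero    = 0
  geometric q (suc b) = suc (q ℕ.* geometric q b)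

  p^b≡1+2t·geometric : ∀ t b → suc (2 ℕ.* t) ℕ.^ b ≡ suc (2 ℕ.* (t ℕ.* geometric (suc (2 ℕ.* t)) b))
  p^b≡1+2t·geometric t zero    = cong (λ n → suc (2 ℕ.* n)) (sym (ℕP.*-zeroʳ t))
  p^b≡1+2t·geometric t (suc b) =
    trans (cong (suc (2 ℕ.* t) ℕ.*_) (p^b≡1+2t·geometric t b)) (expand t (geometric (suc (2 ℕ.* t)) b))
    where expand : ∀ t s → suc (2 ℕ.* t) ℕ.* suc (2 ℕ.* (t ℕ.* s)) ≡ suc (2 ℕ.* (t ℕ.* suc (suc (2 ℕ.* t) ℕ.* s)))
          expand = ℕ-Solver.solve-∀

  module _ (t : ℕ) (p-prime : Prime (suc (2 ℕ.* t))) (a : ℕ) (a≥1 : 1 ≤ a)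
           (m : ℤ) (p∤m : ¬ suc (2 ℕ.* t) ∣ ∣ m ∣) where

    private
      p s h Q : ℕ
      p = suc (2 ℕ.* t)
      s = geometric p a
      h = t ℕ.* s
      Q = 2 ℕ.* h

      p^a≡1+Q : p ℕ.^ a ≡ suc Q
      p^a≡1+Q = p^b≡1+2t·geometric t a

      m≢0 : ¬ m ≡ + 0 [mod p ]
      m≢0 = p∤m ∘ ≡0[mod]⇒∣

      -m≢0 : ¬ - m ≡ + 0 [mod p ]
      -m≢0 = m≢0 ∘ mod-neg-injective

      L : ℤ
      L = legendre (- m) p

      L^p≡L : L ℤ.^ p ≡ L
      L^p≡L = begin
        L ℤ.* L ℤ.^ (2 ℕ.* t)      ≡⟨ cong (L ℤ.*_) (ℤP.^-*-assoc L 2 t) ⟨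
        L ℤ.* (L ℤ.^ 2) ℤ.^ t      ≡⟨ cong (λ x → L ℤ.* x ℤ.^ t) (cong (L ℤ.*_) (ℤP.*-identityʳ L)) ⟩
        L ℤ.* (L ℤ.* L) ℤ.^ t      ≡⟨ cong (λ x → L ℤ.* x ℤ.^ t) (legendre-squared t p-prime -m≢0) ⟩
        L ℤ.* (+ 1) ℤ.^ t          ≡⟨ cong (L ℤ.*_) (ℤP.^-zeroˡ t) ⟩
        L ℤ.* + 1                  ≡⟨ ℤP.*-identityʳ L ⟩
        L                          ∎
        where open ≡-Reasoning

      L^geometric : ∀ b → L ℤ.^ geometric p b ≡ L ℤ.^ b
      L^geometric zero    = refl
      L^geometric (suc b) = cong (L ℤ.*_) (begin
        L ℤ.^ (p ℕ.* geometric p b)     ≡⟨ ℤP.^-*-assoc L p (geometric p b) ⟨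
        (L ℤ.^ p) ℤ.^ geometric p b     ≡⟨ cong (ℤ._^ geometric p b) L^p≡L ⟩
        L ℤ.^ geometric p b             ≡⟨ L^geometric b ⟩
        L ℤ.^ b                         ∎)
        where open ≡-Reasoning

      [m²]^h≡1 : (m ℤ.* m) ℤ.^ h ≡ + 1 [mod p ]
      [m²]^h≡1 = begin
        (m ℤ.* m) ℤ.^ (t ℕ.* s)       ≡⟨ ℤP.^-*-assoc (m ℤ.* m) t s ⟨
        ((m ℤ.* m) ℤ.^ t) ℤ.^ s       ≈⟨ mod-^ s (square^t≡1 t p-prime m≢0) ⟩
        (+ 1) ℤ.^ s                   ≡⟨ ℤP.^-zeroˡ s ⟩
        + 1                           ∎
        where open ≡-mod-Reasoning

      m^Q≡1 : m ℤ.^ Q ≡ + 1 [mod p ]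
      m^Q≡1 = subst (_≡ + 1 [mod p ])
        (trans (cong (λ x → (m ℤ.* x) ℤ.^ h) (sym (ℤP.*-identityʳ m))) (ℤP.^-*-assoc m 2 h)) [m²]^h≡1

      J : ℤ
      J = jacobi (- m) (p ℕ.^ a)

      [-m]^h≡J : (- m) ℤ.^ h ≡ J [mod p ]
      [-m]^h≡J = begin
        (- m) ℤ.^ (t ℕ.* s)       ≡⟨ ℤP.^-*-assoc (- m) t s ⟨
        ((- m) ℤ.^ t) ℤ.^ s       ≈⟨ mod-^ s (euler-criterion t p-prime -m≢0) ⟩
        L ℤ.^ s                   ≡⟨ L^geometric a ⟩
        L ℤ.^ a                   ≡⟨ jacobi-prime-power p-prime (- m) a a≥1 ⟨
        J                         ∎
        where open ≡-mod-Reasoning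

      m^h*J≡[-1]^h : m ℤ.^ h ℤ.* J ≡ -1ℤ ℤ.^ h [mod p ]
      m^h*J≡[-1]^h = begin
        m ℤ.^ h ℤ.* J                       ≈⟨ mod-*ˡ (m ℤ.^ h) [-m]^h≡J ⟨
        m ℤ.^ h ℤ.* (- m) ℤ.^ h             ≡⟨ ^-distribʳ-* m (- m) h ⟨
        (m ℤ.* - m) ℤ.^ h                   ≡⟨ cong (ℤ._^ h) (factor m) ⟩
        (-1ℤ ℤ.* (m ℤ.* m)) ℤ.^ h           ≡⟨ ^-distribʳ-* -1ℤ (m ℤ.* m) h ⟩
        -1ℤ ℤ.^ h ℤ.* (m ℤ.* m) ℤ.^ h       ≈⟨ mod-*ˡ (-1ℤ ℤ.^ h) [m²]^h≡1 ⟩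
        -1ℤ ℤ.^ h ℤ.* + 1                   ≡⟨ ℤP.*-identityʳ (-1ℤ ℤ.^ h) ⟩
        -1ℤ ℤ.^ h                           ∎
        where open ≡-mod-Reasoning
              factor : ∀ m → m ℤ.* - m ≡ -1ℤ ℤ.* (m ℤ.* m)
              factor = ℤ-Solver.solve-∀

      p∤2 : ¬ p ∣ 2
      p∤2 p∣2 =
        ℕP.even≢odd 1 t (sym (ℕP.≤-antisym (ℕD.∣⇒≤ p∣2) (ℕ.nonTrivial⇒n>1 p {{prime⇒nonTrivial p-prime}})))

      p∤2m^N : ∀ N → ¬ p ∣ ∣ + 2 ℤ.* m ℤ.^ N ∣
      p∤2m^N N = mod-*-≢0 p-prime {+ 2} (p∤2 ∘ ≡0[mod]⇒∣) (mod-^-≢0 p-prime N m≢0) ∘ ∣⇒≡0[mod]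

      P : ℕ
      P = p ℕ.^ a

      half-remainder : p ℕ.^ suc a ∣ ∣ + 2 ℤ.* m ℤ.^ h ℤ.* (+ P ℤ.* J) ℤ.- + (suc h ℕ.* ((2 ℕ.* suc h) C suc h)) ∣
      half-remainder = n^a*w⇒n^[1+a]∣ {a = a} (begin
        + 2 ℤ.* m ℤ.^ h ℤ.* (+ P ℤ.* J) ℤ.- + (suc h ℕ.* ((2 ℕ.* suc h) C suc h))
          ≡⟨ cong (λ n → + 2 ℤ.* m ℤ.^ h ℤ.* (+ P ℤ.* J) ℤ.- + n) central≡ ⟩
        + 2 ℤ.* m ℤ.^ h ℤ.* (+ P ℤ.* J) ℤ.- + (2 ℕ.* P ℕ.* (Q C h))
          ≡⟨ cong (λ x → + 2 ℤ.* m ℤ.^ h ℤ.* (+ P ℤ.* J) ℤ.- x) (trans (ℤP.pos-* (2 ℕ.* P) (Q C h)) (cong (ℤ._* + (Q C h)) (ℤP.pos-* 2 P))) ⟩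
        + 2 ℤ.* m ℤ.^ h ℤ.* (+ P ℤ.* J) ℤ.- + 2 ℤ.* + P ℤ.* + (Q C h)
          ≡⟨ factor (m ℤ.^ h) (+ P) J (+ (Q C h)) ⟩
        + P ℤ.* (+ 2 ℤ.* (m ℤ.^ h ℤ.* J ℤ.- + (Q C h)))
          ∎)
        (mod-*ˡ (+ 2) (x≡y⇒x-y≡0 (mod-trans m^h*J≡[-1]^h (mod-sym ([p^a-1]C[k]≡±1 p-prime a p^a≡1+Q (ℕP.m≤n*m h 2))))))
        where
          open ≡-Reasoning
          central≡ : suc h ℕ.* ((2 ℕ.* suc h) C suc h) ≡ 2 ℕ.* P ℕ.* (Q C h)
          central≡ = trans (central-C-step h) (cong (λ n → 2 ℕ.* n ℕ.* (Q C h)) (sym p^a≡1+Q))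
          factor : ∀ x P j b → + 2 ℤ.* x ℤ.* (P ℤ.* j) ℤ.- + 2 ℤ.* P ℤ.* b ≡ P ℤ.* (+ 2 ℤ.* (x ℤ.* j ℤ.- b))
          factor = ℤ-Solver.solve-∀

      full-remainder : p ℕ.^ suc a ∣ ∣ + 2 ℤ.* m ℤ.^ Q ℤ.* + P ℤ.- + (suc Q ℕ.* ((2 ℕ.* suc Q) C suc Q)) ∣
      full-remainder = n^a*w⇒n^[1+a]∣ {a = a} (begin
        + 2 ℤ.* m ℤ.^ Q ℤ.* + P ℤ.- + (suc Q ℕ.* B)
          ≡⟨ cong (λ n → + 2 ℤ.* m ℤ.^ Q ℤ.* + P ℤ.- + (n ℕ.* B)) (sym p^a≡1+Q) ⟩
        + 2 ℤ.* m ℤ.^ Q ℤ.* + P ℤ.- + (P ℕ.* B)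
          ≡⟨ cong (λ x → + 2 ℤ.* m ℤ.^ Q ℤ.* + P ℤ.- x) (ℤP.pos-* P B) ⟩
        + 2 ℤ.* m ℤ.^ Q ℤ.* + P ℤ.- + P ℤ.* + B
          ≡⟨ factor (m ℤ.^ Q) (+ P) (+ B) ⟩
        + P ℤ.* (+ 2 ℤ.* m ℤ.^ Q ℤ.- + B)
          ∎)
        (x≡y⇒x-y≡0 (mod-trans (mod-*ˡ (+ 2) m^Q≡1) (mod-sym ([2p^a]C[p^a]≡2 p-prime a p^a≡1+Q))))
        where
          open ≡-Reasoning
          B = (2 ℕ.* suc Q) C suc Q
          factor : ∀ x P b → + 2 ℤ.* x ℤ.* P ℤ.- P ℤ.* b ≡ P ℤ.* (+ 2 ℤ.* x ℤ.- b)
          factor = ℤ-Solver.solve-∀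

      m≢+0 : m ≢ + 0
      m≢+0 = m≢0 ∘ ≡⇒≡[mod]

      P∸1≡Q : P ∸ 1 ≡ Q
      P∸1≡Q = cong ℕ.pred p^a≡1+Q

      [P∸1]/2≡h : (P ∸ 1) ℕ./ 2 ≡ h
      [P∸1]/2≡h = trans (cong (ℕ._/ 2) (trans P∸1≡Q (ℕP.*-comm 2 h))) (m*n/n≡m h 2)

    half-sum-congruence : CongQ p (suc a) (c m ℚ.* sumTo ((P ∸ 1) ℕ./ 2) (f₁ m))
                                         (sumTo ((P ∸ 1) ℕ./ 2) (f₀ m) ℚ.- ℤtoℚ (+ P ℤ.* J))
    half-sum-congruence = subst (λ N → CongQ p (suc a) (c m ℚ.* sumTo N (f₁ m)) (sumTo N (f₀ m) ℚ.- ℤtoℚ (+ P ℤ.* J)))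
      (sym [P∸1]/2≡h)
      (sum-congruence m m≢+0 p-prime (suc a) h (+ P ℤ.* J) (p∤2m^N h) half-remainder)

    full-sum-congruence : CongQ p (suc a) (c m ℚ.* sumTo (P ∸ 1) (f₁ m)) (sumTo (P ∸ 1) (f₀ m) ℚ.- ℕtoℚ P)
    full-sum-congruence = subst (λ N → CongQ p (suc a) (c m ℚ.* sumTo N (f₁ m)) (sumTo N (f₀ m) ℚ.- ℕtoℚ P))
      (sym P∸1≡Q)
      (sum-congruence m m≢+0 p-prime (suc a) Q (+ P) (p∤2m^N Q) full-remainder)

open CentralBinomialSums using (half-sum-congruence; full-sum-congruence; odd⇒2t+1)
open import Data.Nat using (_^_; _/_; _≥_; _*_)

proposition4p1 : (p a : ℕ) (m : ℤ) → Prime p → ¬ (2 ∣ℤ + p) → a ≥ 1 → ¬ (p ∣ℤ m) →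
  CongQ p (suc a)
    (((m ℤ.- + 4) ℚ./ 2) ℚ.* sumTo ((p ^ a ∸ 1) / 2)
      (λ k → ℕtoℚ (k * ((2 * k) C k)) ℚ.* powℚ (recipℤ m) k))
    (sumTo ((p ^ a ∸ 1) / 2) (λ k → ℕtoℚ ((2 * k) C k) ℚ.* powℚ (recipℤ m) k)
      ℚ.- ℤtoℚ (+ (p ^ a) ℤ.* jacobi (- m) (p ^ a)))
  ×
  CongQ p (suc a)
    (((m ℤ.- + 4) ℚ./ 2) ℚ.* sumTo (p ^ a ∸ 1)
      (λ k → ℕtoℚ (k * ((2 * k) C k)) ℚ.* powℚ (recipℤ m) k))
    (sumTo (p ^ a ∸ 1) (λ k → ℕtoℚ ((2 * k) C k) ℚ.* powℚ (recipℤ m) k)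
      ℚ.- ℕtoℚ (p ^ a))
proposition4p1 p a m p-prime p-odd a≥1 p∤m with odd⇒2t+1 p p-odd
... | t , refl = half-sum-congruence t p-prime a a≥1 m p∤m , full-sum-congruence t p-prime a a≥1 m p∤m
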